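{- Let $k\in\mathbb{Z}^+$, $n\ge 2k+1$, and let $i,j\in[n]$ be distinct. For every $y\in[n]\setminus\{i,j\}$, the number of permutations $\pi\in\mathcal{S}_n$ satisfying $\pi^k(i)=i$ and $\pi^k(j)=y$ is $$\left(\tau(k)n-\tau^2(k)-\sigma(k)\right)(n-3)!.$$
   Context: $\mathcal{S}_n$ is the symmetric group on $[n]=\{1,\dots,n\}$. $\tau(k)$ is the number of positive divisors of $k$ and $\sigma(k)$ is their sum. -}

module Defs where

open import Data.Nat using (ℕ; zero; suc; _+_; _*_)
open import Data.Nat.Divisibility using (_∣?_)
open import Data.Fin using (Fin)
open import Data.Fin.Properties using () renaming (_≟_ to _≟F_)
open import Data.Vec using (Vec; []; _∷_; lookup; toList)
open import Data.List using (List; []; _∷_; [_]; map; concatMap; filter; length; upTo; allFin)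
open import Data.Nat.ListAction using (sum)
open import Data.Product using (_×_)
open import Relation.Nullary.Decidable using (_×-dec_)
open import Relation.Binary.PropositionalEquality using (_≡_)
import Data.List.Relation.Unary.Unique.DecPropositional as UniqueDec

divisors : ℕ → List ℕ
divisors k = filter (λ d → d ∣? k) (map suc (upTo k))

τ : ℕ → ℕ
τ k = length (divisors k)

σ : ℕ → ℕ
σ k = sum (divisors k)

allMaps : (m n : ℕ) → List (Vec (Fin n) m)
allMaps zero    n = [ [] ]
allMaps (suc m) n = concatMap (λ x → map (x ∷_) (allMaps m n)) (allFin n)

-- S_n: the self-maps of [n] with pairwise distinct images (= bijections of [n]),
-- each represented by its vector of images (π(0), …, π(n-1))
Sym : (n : ℕ) → List (Vec (Fin n) n)
Sym n = filter (λ v → UniqueDec.unique? _≟F_ (toList v)) (allMaps n n)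

iter : {A : Set} → ℕ → (A → A) → A → A
iter zero    f x = x
iter (suc k) f x = f (iter k f x)

pow : {n : ℕ} → Vec (Fin n) n → ℕ → Fin n → Fin n
pow π k x = iter k (lookup π) x

count : (n k : ℕ) → Fin n → Fin n → Fin n → ℕ
count n k i j y =
  length (filter (λ π → (pow π k i ≟F i) ×-dec (pow π k j ≟F y)) (Sym n))

module Submission where

-- Let d be the period of i under π and, if j returns to itself within k steps, e the period of j.
-- Then π^k(i) = i says d ∣ k, and π^k(j) = y ≠ j says that either e ≤ k, e ∤ k and y lies k mod e
-- steps after j on its cycle, or j does not return within k steps and y = π^k(j) ends the path
-- j, π(j), …, π^k(j). Given d and this shape of j, such a π amounts to an injective word in the
-- n − 3 points other than i, j, y (the remaining points of the cycle of i and of the cycle or path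
-- of j) plus an arbitrary permutation extending these chains, so that each cycle shape contributes
-- (n − 3)! and the path shape (n − d − k)(n − 3)!. Summing over the k − τ(k) non-divisors e ≤ k and
-- the divisors d of k gives ∑_d (n − τ(k) − d)(n − 3)! = (τ(k)n − τ(k)² − σ(k))(n − 3)!.

open import Defs
open import Data.Nat using (ℕ; zero; suc; _+_; _*_; _∸_; _≤_; _<_; z≤n; s≤s; s≤s⁻¹; NonZero; _%_; _/_; _⊓_; _!)
open import Data.Nat.Properties
import Algebra.Properties.CommutativeSemigroup +-commutativeSemigroup as +-Semigroup
import Algebra.Properties.CommutativeSemigroup *-commutativeSemigroup as *-Semigroup
open import Data.Nat.DivMod using (m≡m%n+[m/n]*n; m%n<n)
open import Data.Nat.Divisibility using (_∣_; _∣?_; divides; m%n≡0⇒n∣m)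
open import Data.Nat.ListAction using (sum)
open import Data.Nat.Tactic.RingSolver using (solve-∀)
open import Data.Integer using (ℤ; +_; _-_) renaming (_*_ to _*ℤ_; _+_ to _+ℤ_)
import Data.Integer.Properties as ℤ
import Data.Integer.Tactic.RingSolver as ℤ-Solver
open import Data.Maybe using (Maybe; just; nothing; Is-just)
import Data.Maybe.Properties as Maybe
import Data.Maybe.Relation.Unary.Any as Maybe
open import Data.List using (List; []; _∷_; _++_; [_]; _∷ʳ_; length; map; filter; concatMap; allFin; upTo; take; drop)
import Data.List.Properties as List
open import Data.List.Membership.Propositional using (_∈_; _∉_)
open import Data.List.Membership.Propositional.Properties
  using (∈-++⁺ˡ; ∈-++⁺ʳ; ∈-++⁻; ∈-map⁺; ∈-map⁻; ∈-filter⁺; ∈-filter⁻; ∈-upTo⁺; ∈-upTo⁻)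
open import Data.List.Relation.Unary.Any using (here; there; any?)
open import Data.List.Relation.Unary.Any.Properties using (¬Any[])
open import Data.List.Relation.Unary.All as All using (All; []; _∷_; all?)
import Data.List.Relation.Unary.All.Properties as All
open import Data.List.Relation.Unary.All.Properties using (¬Any⇒All¬)
open import Data.List.Relation.Unary.Unique.Propositional using (Unique; []; _∷_)
import Data.List.Relation.Unary.Unique.Propositional.Properties as Unique
import Data.List.Relation.Unary.Unique.DecPropositional as UniqueDec
import Data.List.Relation.Unary.AllPairs as AllPairs
open import Data.List.Relation.Binary.Disjoint.Propositional using (Disjoint)
open import Data.List.Relation.Binary.Permutation.Propositional
  using (_↭_; prep; swap; ↭-refl; ↭-sym; ↭-trans; ↭⇒↭ₛ; module PermutationReasoning)
open import Data.List.Relation.Binary.Permutation.Propositional.Properties using (shift; ++⁺; ∷↭∷ʳ; ↭-length)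
open import Data.List.Relation.Binary.Permutation.Setoid.Properties using (Unique-resp-↭)
open import Data.Fin using (Fin; zero; suc) renaming (_≟_ to _≟ᶠ_)
import Data.Fin.Properties as Fin
open import Data.Vec using (Vec; []; _∷_; toList; replicate; lookup; tabulate)
open import Data.Vec.Properties using (lookup∘tabulate; length-toList)
open import Data.Vec.Membership.Propositional.Properties using (∈-toList⁺; ∈-lookup)
open import Data.Product using (∃; _×_; _,_; proj₁; proj₂)
import Data.Product as Product
open import Data.Product.Function.NonDependent.Propositional using (_×-⇔_)
open import Data.Sum using (inj₁; inj₂; [_,_]′)
open import Data.Unit using (⊤; tt)
open import Data.Empty using (⊥-elim)
open import Relation.Nullary using (Dec; yes; no; ¬_)
open import Relation.Nullary.Decidable using (_×-dec_; ¬?)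
open import Relation.Unary using (Pred; Decidable)
open import Relation.Binary using (DecidableEquality; tri<; tri≈; tri>)
open import Relation.Binary.PropositionalEquality hiding ([_]; J)
open import Function using (_∘_; _⇔_; mk⇔; Equivalence)
import Function.Properties.Equivalence as ⇔
open import Function.Definitions using (Injective)

private
  variable
    A B : Set

∑ : List A → (A → ℕ) → ℕ
∑ []       f = 0
∑ (x ∷ xs) f = f x + ∑ xs f

infix 5 ∑
syntax ∑ xs (λ x → e) = ∑[ x ∈ xs ] e

𝟙 : ∀ {p} {P : Set p} → Dec P → ℕ
𝟙 (yes _) = 1
𝟙 (no _)  = 0

module _ {p} {P : Set p} where

  𝟙-yes : (P? : Dec P) → P → 𝟙 P? ≡ 1
  𝟙-yes (yes _) _  = refl
  𝟙-yes (no ¬p) p = ⊥-elim (¬p p)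

  𝟙-no : (P? : Dec P) → ¬ P → 𝟙 P? ≡ 0
  𝟙-no (yes p) ¬p = ⊥-elim (¬p p)
  𝟙-no (no _)  _  = refl

  𝟙-¬+𝟙 : (P? : Dec P) → 𝟙 (¬? P?) + 𝟙 P? ≡ 1
  𝟙-¬+𝟙 (yes _) = refl
  𝟙-¬+𝟙 (no _)  = refl

  𝟙-cong : ∀ {q} {Q : Set q} (P? : Dec P) (Q? : Dec Q) → P ⇔ Q → 𝟙 P? ≡ 𝟙 Q?
  𝟙-cong (yes _) (yes _) _   = refl
  𝟙-cong (yes p) (no ¬q) p⇔q = ⊥-elim (¬q (Equivalence.to p⇔q p))
  𝟙-cong (no ¬p) (yes q) p⇔q = ⊥-elim (¬p (Equivalence.from p⇔q q))
  𝟙-cong (no _)  (no _)  _   = refl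

  𝟙-× : ∀ {q} {Q : Set q} (P? : Dec P) (Q? : Dec Q) → 𝟙 (P? ×-dec Q?) ≡ 𝟙 P? * 𝟙 Q?
  𝟙-× (yes _) (yes _) = refl
  𝟙-× (yes _) (no _)  = refl
  𝟙-× (no _)  _       = refl

length-filter : ∀ {p} {P : Pred A p} (P? : Decidable P) xs → length (filter P? xs) ≡ ∑[ x ∈ xs ] 𝟙 (P? x)
length-filter P? []       = refl
length-filter P? (x ∷ xs) with P? x
... | yes _ = cong suc (length-filter P? xs)
... | no _  = length-filter P? xs

length-filter-filter : ∀ {p q} {P : Pred A p} {Q : Pred A q} (P? : Decidable P) (Q? : Decidable Q) xs →
  length (filter Q? (filter P? xs)) ≡ ∑[ x ∈ xs ] 𝟙 (P? x) * 𝟙 (Q? x)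
length-filter-filter P? Q? []       = refl
length-filter-filter P? Q? (x ∷ xs) with P? x
... | no _ = length-filter-filter P? Q? xs
... | yes _ with Q? x
...   | yes _ = cong suc (length-filter-filter P? Q? xs)
...   | no _  = length-filter-filter P? Q? xs

module _ {f g : A → ℕ} where

  ∑-cong : ∀ xs → (∀ x → f x ≡ g x) → ∑ xs f ≡ ∑ xs g
  ∑-cong []       _   = refl
  ∑-cong (x ∷ xs) f≗g = cong₂ _+_ (f≗g x) (∑-cong xs f≗g)

  ∑-cong-∈ : ∀ xs → (∀ {x} → x ∈ xs → f x ≡ g x) → ∑ xs f ≡ ∑ xs g
  ∑-cong-∈ []       _   = refl
  ∑-cong-∈ (x ∷ xs) f≗g = cong₂ _+_ (f≗g (here refl)) (∑-cong-∈ xs (f≗g ∘ there))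

  ∑-+ : ∀ xs → ∑[ x ∈ xs ] (f x + g x) ≡ ∑ xs f + ∑ xs g
  ∑-+ []       = refl
  ∑-+ (x ∷ xs) = trans (cong (_+_ (f x + g x)) (∑-+ xs)) (+-Semigroup.interchange (f x) (g x) _ _)

∑-++ : ∀ (xs ys : List A) f → ∑ (xs ++ ys) f ≡ ∑ xs f + ∑ ys f
∑-++ []       ys f = refl
∑-++ (x ∷ xs) ys f = trans (cong (_+_ (f x)) (∑-++ xs ys f)) (sym (+-assoc (f x) _ _))

∑-*ˡ : ∀ (xs : List A) c f → ∑[ x ∈ xs ] (c * f x) ≡ c * ∑ xs f
∑-*ˡ []       c f = sym (*-zeroʳ c)
∑-*ˡ (x ∷ xs) c f = trans (cong (_+_ (c * f x)) (∑-*ˡ xs c f)) (sym (*-distribˡ-+ c (f x) _))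

∑-const : ∀ (xs : List A) c → ∑[ _ ∈ xs ] c ≡ length xs * c
∑-const []       c = refl
∑-const (x ∷ xs) c = cong (_+_ c) (∑-const xs c)

∑-zero : ∀ (xs : List A) → ∑[ _ ∈ xs ] 0 ≡ 0
∑-zero xs = trans (∑-const xs 0) (*-zeroʳ (length xs))

∑-map : ∀ (g : A → B) xs f → ∑ (map g xs) f ≡ ∑ xs (f ∘ g)
∑-map g []       f = refl
∑-map g (x ∷ xs) f = cong (_+_ (f (g x))) (∑-map g xs f)

∑-concatMap : ∀ (g : A → List B) xs f → ∑ (concatMap g xs) f ≡ ∑[ x ∈ xs ] ∑ (g x) f
∑-concatMap g []       f = refl
∑-concatMap g (x ∷ xs) f = trans (∑-++ (g x) _ f) (cong (_+_ (∑ (g x) f)) (∑-concatMap g xs f))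

∑-comm : ∀ (xs : List A) (ys : List B) (f : A → B → ℕ) → ∑[ x ∈ xs ] ∑[ y ∈ ys ] f x y ≡ ∑[ y ∈ ys ] ∑[ x ∈ xs ] f x y
∑-comm []       ys f = sym (∑-zero ys)
∑-comm (x ∷ xs) ys f = trans (cong (_+_ (∑ ys (f x))) (∑-comm xs ys f)) (sym (∑-+ ys))

∑-𝟙¬+∑-𝟙 : ∀ {p} {P : Pred A p} (P? : Decidable P) xs → (∑[ x ∈ xs ] 𝟙 (¬? (P? x))) + (∑[ x ∈ xs ] 𝟙 (P? x)) ≡ length xs
∑-𝟙¬+∑-𝟙 P? xs = trans (sym (∑-+ xs)) (trans (∑-cong xs (λ x → 𝟙-¬+𝟙 (P? x))) (trans (∑-const xs 1) (*-identityʳ (length xs))))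

∑-allFin-suc : ∀ {n} (g : Fin (suc n) → ℕ) → ∑ (allFin (suc n)) g ≡ g zero + (∑[ x ∈ allFin n ] g (suc x))
∑-allFin-suc {n} g = cong (_+_ (g zero)) (trans (cong (λ xs → ∑ xs g) (sym (List.map-tabulate (λ x → x) suc))) (∑-map suc (allFin n) g))

∑-pick : ∀ {n} (b : Fin n) (f : Fin n → ℕ) → ∑[ x ∈ allFin n ] 𝟙 (x ≟ᶠ b) * f x ≡ f b
∑-pick {suc n} zero f =
  trans (∑-allFin-suc (λ x → 𝟙 (x ≟ᶠ zero) * f x)) (trans (cong₂ _+_ (*-identityˡ (f zero)) others) (+-identityʳ (f zero)))
  where
  others : ∑[ x ∈ allFin n ] 𝟙 (suc x ≟ᶠ zero) * f (suc x) ≡ 0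
  others = trans (∑-cong (allFin n) (λ x → cong (_* f (suc x)) (𝟙-no (suc x ≟ᶠ zero) λ ()))) (∑-zero (allFin n))
∑-pick {suc n} (suc b) f = trans (∑-allFin-suc (λ x → 𝟙 (x ≟ᶠ suc b) * f x)) (trans (∑-cong (allFin n) predecessor) (∑-pick b (f ∘ suc)))
  where
  predecessor : ∀ x → 𝟙 (suc x ≟ᶠ suc b) * f (suc x) ≡ 𝟙 (x ≟ᶠ b) * f (suc x)
  predecessor x = cong (_* f (suc x)) (𝟙-cong (suc x ≟ᶠ suc b) (x ≟ᶠ b) (mk⇔ Fin.suc-injective (cong suc)))

count-≡ : ∀ {n} (b : Fin n) → ∑[ x ∈ allFin n ] 𝟙 (x ≟ᶠ b) ≡ 1
count-≡ {n} b = trans (∑-cong (allFin n) (λ x → sym (*-identityʳ (𝟙 (x ≟ᶠ b))))) (∑-pick b (λ _ → 1))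

infix 4 _∈?_
_∈?_ : ∀ {n} (x : Fin n) (xs : List (Fin n)) → Dec (x ∈ xs)
x ∈? xs = any? (x ≟ᶠ_) xs

count-∈ : ∀ {n} (xs : List (Fin n)) → Unique xs → ∑[ x ∈ allFin n ] 𝟙 (x ∈? xs) ≡ length xs
count-∈ {n} []       _          = ∑-zero (allFin n)
count-∈ {n} (a ∷ xs) (a∉ ∷ !xs) = begin
  ∑[ x ∈ allFin n ] 𝟙 (x ∈? a ∷ xs)               ≡⟨ ∑-cong (allFin n) (λ x → split x (x ≟ᶠ a) (x ∈? xs)) ⟩
  ∑[ x ∈ allFin n ] (𝟙 (x ≟ᶠ a) + 𝟙 (x ∈? xs))   ≡⟨ ∑-+ (allFin n) ⟩
  (∑[ x ∈ allFin n ] 𝟙 (x ≟ᶠ a)) + (∑[ x ∈ allFin n ] 𝟙 (x ∈? xs)) ≡⟨ cong₂ _+_ (count-≡ a) (count-∈ xs !xs) ⟩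
  suc (length xs)                                  ∎
  where
  open ≡-Reasoning
  split : ∀ x (x≟a : Dec (x ≡ a)) (x∈?xs : Dec (x ∈ xs)) → 𝟙 (x ∈? a ∷ xs) ≡ 𝟙 x≟a + 𝟙 x∈?xs
  split x (yes refl) (yes x∈xs) = ⊥-elim (All.lookup a∉ x∈xs refl)
  split x (yes refl) (no _)     = 𝟙-yes (x ∈? a ∷ xs) (here refl)
  split x (no _)     (yes x∈xs) = 𝟙-yes (x ∈? a ∷ xs) (there x∈xs)
  split x (no x≢a)   (no x∉xs)  = 𝟙-no (x ∈? a ∷ xs) λ { (here x≡a) → x≢a x≡a ; (there x∈xs) → x∉xs x∈xs }

count-∉ : ∀ {n} (xs : List (Fin n)) → Unique xs → ∑[ x ∈ allFin n ] 𝟙 (¬? (x ∈? xs)) ≡ n ∸ length xs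
count-∉ {n} xs !xs = begin
  ∑-∉
    ≡⟨ m+n∸n≡m ∑-∉ (length xs) ⟨
  ∑-∉ + length xs ∸ length xs
    ≡⟨ cong (λ l → ∑-∉ + l ∸ length xs) (count-∈ xs !xs) ⟨
  ∑-∉ + (∑[ x ∈ allFin n ] 𝟙 (x ∈? xs)) ∸ length xs
    ≡⟨ cong (_∸ length xs) (∑-𝟙¬+∑-𝟙 (_∈? xs) (allFin n)) ⟩
  length (allFin n) ∸ length xs
    ≡⟨ cong (_∸ length xs) (List.length-tabulate (λ x → x)) ⟩
  n ∸ length xs ∎
  where
  open ≡-Reasoning
  ∑-∉ : ℕ
  ∑-∉ = ∑[ x ∈ allFin n ] 𝟙 (¬? (x ∈? xs))

∑-allMaps-suc : ∀ {m n} (f : Vec (Fin n) (suc m) → ℕ) →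
  ∑ (allMaps (suc m) n) f ≡ ∑[ x ∈ allFin n ] ∑[ w ∈ allMaps m n ] f (x ∷ w)
∑-allMaps-suc {m} {n} f = trans (∑-concatMap _ (allFin n) f) (∑-cong (allFin n) (λ x → ∑-map (x ∷_) (allMaps m n) f))

infix 4 _≟ˡ_
_≟ˡ_ : ∀ {n} (xs ys : List (Fin n)) → Dec (xs ≡ ys)
_≟ˡ_ = List.≡-dec _≟ᶠ_

count-toList-≡ : ∀ {m n} (xs : List (Fin n)) → length xs ≡ m → ∑[ w ∈ allMaps m n ] 𝟙 (toList w ≟ˡ xs) ≡ 1
count-toList-≡ {zero}      []       refl = refl
count-toList-≡ {suc m} {n} (x ∷ xs) |xs| = begin
  ∑[ w ∈ allMaps (suc m) n ] 𝟙 (toList w ≟ˡ x ∷ xs)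
    ≡⟨ ∑-allMaps-suc (λ w → 𝟙 (toList w ≟ˡ x ∷ xs)) ⟩
  ∑[ z ∈ allFin n ] ∑[ w ∈ allMaps m n ] 𝟙 (z ∷ toList w ≟ˡ x ∷ xs)
    ≡⟨ ∑-cong (allFin n) split ⟩
  ∑[ z ∈ allFin n ] 𝟙 (z ≟ᶠ x) * (∑[ w ∈ allMaps m n ] 𝟙 (toList w ≟ˡ xs))
    ≡⟨ ∑-pick x _ ⟩
  ∑[ w ∈ allMaps m n ] 𝟙 (toList w ≟ˡ xs)
    ≡⟨ count-toList-≡ xs (suc-injective |xs|) ⟩
  1 ∎
  where
  open ≡-Reasoning
  split : ∀ z → ∑[ w ∈ allMaps m n ] 𝟙 (z ∷ toList w ≟ˡ x ∷ xs) ≡ 𝟙 (z ≟ᶠ x) * (∑[ w ∈ allMaps m n ] 𝟙 (toList w ≟ˡ xs))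
  split z = trans (∑-cong (allMaps m n) (λ w → trans (𝟙-cong _ (z ≟ᶠ x ×-dec toList w ≟ˡ xs) ∷-≡⇔)
                                                      (𝟙-× (z ≟ᶠ x) (toList w ≟ˡ xs))))
                  (∑-*ˡ (allMaps m n) (𝟙 (z ≟ᶠ x)) _)
    where
    ∷-≡⇔ : ∀ {w : List (Fin n)} → (z ∷ w ≡ x ∷ xs) ⇔ (z ≡ x × w ≡ xs)
    ∷-≡⇔ = mk⇔ List.∷-injective λ (p , q) → cong₂ _∷_ p q

𝟙-*-cong : ∀ {p} {P : Set p} (P? : Dec P) {a b} → (P → a ≡ b) → 𝟙 P? * a ≡ 𝟙 P? * b
𝟙-*-cong (yes p) a≡b = cong (1 *_) (a≡b p)
𝟙-*-cong (no _)  _   = refl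

count-unique-witness : ∀ {m n q t} {Q : Vec (Fin n) m → Set q} {T : Set t} (Q? : ∀ w → Dec (Q w)) (T? : Dec T) (xs : List (Fin n)) →
  length xs ≡ m → (∀ w → Q w ⇔ (T × toList w ≡ xs)) → ∑[ w ∈ allMaps m n ] 𝟙 (Q? w) ≡ 𝟙 T?
count-unique-witness {m} {n} Q? T? xs |xs| Q⇔ = begin
  ∑[ w ∈ allMaps m n ] 𝟙 (Q? w)
    ≡⟨ ∑-cong (allMaps m n) (λ w → trans (𝟙-cong (Q? w) _ (Q⇔ w)) (𝟙-× T? (toList w ≟ˡ xs))) ⟩
  ∑[ w ∈ allMaps m n ] 𝟙 T? * 𝟙 (toList w ≟ˡ xs)
    ≡⟨ ∑-*ˡ (allMaps m n) (𝟙 T?) _ ⟩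
  𝟙 T? * (∑[ w ∈ allMaps m n ] 𝟙 (toList w ≟ˡ xs))
    ≡⟨ cong (𝟙 T? *_) (count-toList-≡ xs |xs|) ⟩
  𝟙 T? * 1
    ≡⟨ *-identityʳ (𝟙 T?) ⟩
  𝟙 T? ∎
  where open ≡-Reasoning

module _ (_≟_ : DecidableEquality A) where

  count-≡-∉ : ∀ {v} xs → v ∉ xs → ∑[ x ∈ xs ] 𝟙 (v ≟ x) ≡ 0
  count-≡-∉ xs v∉ = trans (∑-cong-∈ xs (λ x∈ → 𝟙-no (_ ≟ _) (λ { refl → v∉ x∈ }))) (∑-zero xs)

  count-≡-∈ : ∀ {v} xs → Unique xs → v ∈ xs → ∑[ x ∈ xs ] 𝟙 (v ≟ x) ≡ 1
  count-≡-∈ (x ∷ xs) (x∉ ∷ _)   (here refl) =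
    cong₂ _+_ (𝟙-yes (x ≟ x) refl) (count-≡-∉ xs (λ x∈ → All.lookup x∉ x∈ refl))
  count-≡-∈ (x ∷ xs) (x∉ ∷ !xs) (there v∈)  =
    cong₂ _+_ (𝟙-no (_ ≟ x) (λ { refl → All.lookup x∉ v∈ refl })) (count-≡-∈ xs !xs v∈)

∑-*ʳ : ∀ (xs : List A) f c → (∑ xs f) * c ≡ ∑[ x ∈ xs ] f x * c
∑-*ʳ xs f c = trans (*-comm (∑ xs f) c) (trans (sym (∑-*ˡ xs c f)) (∑-cong xs (λ x → *-comm c (f x))))

-- Falling factorials and injective words with prescribed entries

falling : ℕ → ℕ → ℕ
falling a zero    = 1
falling a (suc m) = a * falling (a ∸ 1) m

[a∸m]!*falling≡a! : ∀ {a m} → m ≤ a → (a ∸ m) ! * falling a m ≡ a !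
[a∸m]!*falling≡a! {a}     {zero}  _         = *-identityʳ (a !)
[a∸m]!*falling≡a! {suc a} {suc m} (s≤s m≤a) =
  trans (*-Semigroup.x∙yz≈y∙xz ((a ∸ m) !) (suc a) (falling a m)) (cong (suc a *_) ([a∸m]!*falling≡a! m≤a))

falling-diag : ∀ a → falling a a ≡ a !
falling-diag a = trans (sym (*-identityˡ (falling a a)))
                       (trans (cong (λ m → m ! * falling a a) (sym (n∸n≡0 a))) ([a∸m]!*falling≡a! (≤-refl {a})))

m∸[1+n]∸o≡m∸n∸[1+o] : ∀ m n o → m ∸ suc n ∸ o ≡ m ∸ n ∸ suc o
m∸[1+n]∸o≡m∸n∸[1+o] m n o = trans (∸-+-assoc m (suc n) o) (trans (cong (m ∸_) (sym (+-suc n o))) (sym (∸-+-assoc m n (suc o))))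

m∸[1+n]∸o≡m∸n∸o∸1 : ∀ m n o → m ∸ suc n ∸ o ≡ m ∸ n ∸ o ∸ 1
m∸[1+n]∸o≡m∸n∸o∸1 m n o =
  trans (m∸[1+n]∸o≡m∸n∸[1+o] m n o) (trans (cong (m ∸ n ∸_) (+-comm 1 o)) (sym (∸-+-assoc (m ∸ n) o 1)))

disjoint-∷ : ∀ {x : A} {xs ys} → x ∉ ys → Disjoint xs ys → Disjoint (x ∷ xs) ys
disjoint-∷ x∉ys _     (here refl , x∈ys) = x∉ys x∈ys
disjoint-∷ _    xs#ys (there v∈xs , v∈ys) = xs#ys (v∈xs , v∈ys)

module _ {n : ℕ} where

  Fits : Maybe (Fin n) → Fin n → Set
  Fits nothing  _ = ⊤
  Fits (just b) x = x ≡ b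

  fits? : ∀ c x → Dec (Fits c x)
  fits? nothing  _ = yes tt
  fits? (just b) x = x ≟ᶠ b

  Admissible : ∀ {m} → List (Fin n) → Vec (Maybe (Fin n)) m → Vec (Fin n) m → Set
  Admissible U []       []      = ⊤
  Admissible U (c ∷ cs) (x ∷ w) = x ∉ U × Fits c x × Admissible (x ∷ U) cs w

  admissible? : ∀ {m} U (cs : Vec (Maybe (Fin n)) m) w → Dec (Admissible U cs w)
  admissible? U []       []      = yes tt
  admissible? U (c ∷ cs) (x ∷ w) = ¬? (x ∈? U) ×-dec (fits? c x ×-dec admissible? (x ∷ U) cs w)

  prescribed : ∀ {m} → Vec (Maybe (Fin n)) m → List (Fin n)
  prescribed []             = []
  prescribed (nothing ∷ cs) = prescribed cs
  prescribed (just b ∷ cs)  = b ∷ prescribed cs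

  length-prescribed≤ : ∀ {m} (cs : Vec (Maybe (Fin n)) m) → length (prescribed cs) ≤ m
  length-prescribed≤ []             = z≤n
  length-prescribed≤ (nothing ∷ cs) = m≤n⇒m≤1+n (length-prescribed≤ cs)
  length-prescribed≤ (just b ∷ cs)  = s≤s (length-prescribed≤ cs)

  admissible⇒prescribed∉ : ∀ {m} U (cs : Vec (Maybe (Fin n)) m) w → Admissible U cs w → Disjoint U (prescribed cs)
  admissible⇒prescribed∉ U (nothing ∷ cs) (x ∷ w) (_ , _ , adm) (b∈U , b∈cs) =
    admissible⇒prescribed∉ (x ∷ U) cs w adm (there b∈U , b∈cs)
  admissible⇒prescribed∉ U (just b ∷ cs) (x ∷ w) (x∉U , refl , adm) (b∈U , here refl) = x∉U b∈U
  admissible⇒prescribed∉ U (just b ∷ cs) (x ∷ w) (x∉U , refl , adm) (b∈U , there b∈cs) =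
    admissible⇒prescribed∉ (x ∷ U) cs w adm (there b∈U , b∈cs)

  #admissible : ∀ m → List (Fin n) → Vec (Maybe (Fin n)) m → ℕ
  #admissible m U cs = ∑[ w ∈ allMaps m n ] 𝟙 (admissible? U cs w)

  #admissible-suc : ∀ {m} U c (cs : Vec (Maybe (Fin n)) m) →
    #admissible (suc m) U (c ∷ cs) ≡ ∑[ x ∈ allFin n ] 𝟙 (¬? (x ∈? U)) * (𝟙 (fits? c x) * #admissible m (x ∷ U) cs)
  #admissible-suc {m} U c cs = trans (∑-allMaps-suc (λ w → 𝟙 (admissible? U (c ∷ cs) w))) (∑-cong (allFin n) first)
    where
    first : ∀ x → ∑[ w ∈ allMaps m n ] 𝟙 (admissible? U (c ∷ cs) (x ∷ w))
                ≡ 𝟙 (¬? (x ∈? U)) * (𝟙 (fits? c x) * #admissible m (x ∷ U) cs)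
    first x = begin
      ∑[ w ∈ allMaps m n ] 𝟙 (admissible? U (c ∷ cs) (x ∷ w))
        ≡⟨ ∑-cong (allMaps m n) (λ w → trans (𝟙-× (¬? (x ∈? U)) _) (cong (𝟙 (¬? (x ∈? U)) *_) (𝟙-× (fits? c x) _))) ⟩
      ∑[ w ∈ allMaps m n ] 𝟙 (¬? (x ∈? U)) * (𝟙 (fits? c x) * 𝟙 (admissible? (x ∷ U) cs w))
        ≡⟨ ∑-*ˡ (allMaps m n) (𝟙 (¬? (x ∈? U))) _ ⟩
      𝟙 (¬? (x ∈? U)) * (∑[ w ∈ allMaps m n ] 𝟙 (fits? c x) * 𝟙 (admissible? (x ∷ U) cs w))
        ≡⟨ cong (𝟙 (¬? (x ∈? U)) *_) (∑-*ˡ (allMaps m n) (𝟙 (fits? c x)) _) ⟩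
      𝟙 (¬? (x ∈? U)) * (𝟙 (fits? c x) * #admissible m (x ∷ U) cs) ∎
      where open ≡-Reasoning

  #admissible-blocked : ∀ {m} U (cs : Vec (Maybe (Fin n)) m) {x} → x ∈ prescribed cs → #admissible m (x ∷ U) cs ≡ 0
  #admissible-blocked {m} U cs x∈cs =
    trans (∑-cong (allMaps m n) (λ w → 𝟙-no (admissible? _ cs w) λ adm → admissible⇒prescribed∉ _ cs w adm (here refl , x∈cs)))
          (∑-zero (allMaps m n))

  #admissible-just : ∀ {m} U b (cs : Vec (Maybe (Fin n)) m) → b ∉ U →
    #admissible (suc m) U (just b ∷ cs) ≡ #admissible m (b ∷ U) cs
  #admissible-just {m} U b cs b∉U = begin
    #admissible (suc m) U (just b ∷ cs)
      ≡⟨ #admissible-suc U (just b) cs ⟩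
    ∑[ x ∈ allFin n ] 𝟙 (¬? (x ∈? U)) * (𝟙 (x ≟ᶠ b) * #admissible m (x ∷ U) cs)
      ≡⟨ ∑-cong (allFin n) (λ x → *-Semigroup.x∙yz≈y∙xz (𝟙 (¬? (x ∈? U))) (𝟙 (x ≟ᶠ b)) _) ⟩
    ∑[ x ∈ allFin n ] 𝟙 (x ≟ᶠ b) * (𝟙 (¬? (x ∈? U)) * #admissible m (x ∷ U) cs)
      ≡⟨ ∑-pick b _ ⟩
    𝟙 (¬? (b ∈? U)) * #admissible m (b ∷ U) cs
      ≡⟨ cong (_* #admissible m (b ∷ U) cs) (𝟙-yes (¬? (b ∈? U)) b∉U) ⟩
    1 * #admissible m (b ∷ U) cs
      ≡⟨ *-identityˡ _ ⟩
    #admissible m (b ∷ U) cs ∎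
    where open ≡-Reasoning

  #admissible-nothing : ∀ {m} U (cs : Vec (Maybe (Fin n)) m) F → Unique (U ++ prescribed cs) →
    (∀ {x} → x ∉ U → x ∉ prescribed cs → #admissible m (x ∷ U) cs ≡ F) →
    #admissible (suc m) U (nothing ∷ cs) ≡ (n ∸ length (U ++ prescribed cs)) * F
  #admissible-nothing {m} U cs F !Ucs fresh = begin
    #admissible (suc m) U (nothing ∷ cs)
      ≡⟨ #admissible-suc U nothing cs ⟩
    ∑[ x ∈ allFin n ] 𝟙 (¬? (x ∈? U)) * (1 * #admissible m (x ∷ U) cs)
      ≡⟨ ∑-cong (allFin n) (λ x → term x (x ∈? U) (x ∈? prescribed cs)) ⟩
    ∑[ x ∈ allFin n ] 𝟙 (¬? (x ∈? U ++ prescribed cs)) * F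
      ≡⟨ ∑-*ʳ (allFin n) (λ x → 𝟙 (¬? (x ∈? U ++ prescribed cs))) F ⟨
    (∑[ x ∈ allFin n ] 𝟙 (¬? (x ∈? U ++ prescribed cs))) * F
      ≡⟨ cong (_* F) (count-∉ (U ++ prescribed cs) !Ucs) ⟩
    (n ∸ length (U ++ prescribed cs)) * F ∎
    where
    open ≡-Reasoning
    term : ∀ x → Dec (x ∈ U) → Dec (x ∈ prescribed cs) →
      𝟙 (¬? (x ∈? U)) * (1 * #admissible m (x ∷ U) cs) ≡ 𝟙 (¬? (x ∈? U ++ prescribed cs)) * F
    term x (yes x∈U) _ = trans (cong (_* (1 * #admissible m (x ∷ U) cs)) (𝟙-no (¬? (x ∈? U)) (λ x∉U → x∉U x∈U)))
                               (sym (cong (_* F) (𝟙-no (¬? (x ∈? U ++ prescribed cs)) (λ x∉ → x∉ (∈-++⁺ˡ x∈U)))))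
    term x (no x∉U) (yes x∈cs) = trans (cong (λ c → 𝟙 (¬? (x ∈? U)) * (1 * c)) (#admissible-blocked U cs x∈cs))
      (trans (*-zeroʳ (𝟙 (¬? (x ∈? U)))) (sym (cong (_* F) (𝟙-no (¬? (x ∈? U ++ prescribed cs)) (λ x∉ → x∉ (∈-++⁺ʳ U x∈cs))))))
    term x (no x∉U) (no x∉cs) = cong₂ _*_ (trans (𝟙-yes (¬? (x ∈? U)) x∉U) (sym (𝟙-yes (¬? (x ∈? U ++ prescribed cs)) x∉U++cs)))
                                          (trans (*-identityˡ (#admissible m (x ∷ U) cs)) (fresh x∉U x∉cs))
      where
      x∉U++cs : x ∉ U ++ prescribed cs
      x∉U++cs x∈ = [ x∉U , x∉cs ]′ (∈-++⁻ U x∈)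

  count-admissible : ∀ m U (cs : Vec (Maybe (Fin n)) m) → Unique U → Unique (prescribed cs) → Disjoint U (prescribed cs) →
    #admissible m U cs ≡ falling (n ∸ length U ∸ length (prescribed cs)) (m ∸ length (prescribed cs))
  count-admissible zero    U []             _ _ _ = refl
  count-admissible (suc m) U (just b ∷ cs)  !U (b∉cs ∷ !cs) U#cs = begin
    #admissible (suc m) U (just b ∷ cs)
      ≡⟨ #admissible-just U b cs b∉U ⟩
    #admissible m (b ∷ U) cs
      ≡⟨ count-admissible m (b ∷ U) cs (¬Any⇒All¬ U b∉U ∷ !U) !cs
           (disjoint-∷ (λ b∈cs → All.lookup b∉cs b∈cs refl) (U#cs ∘ Product.map₂ there)) ⟩
    falling (n ∸ suc (length U) ∸ length (prescribed cs)) (m ∸ length (prescribed cs))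
      ≡⟨ cong (λ a → falling a (m ∸ length (prescribed cs))) (m∸[1+n]∸o≡m∸n∸[1+o] n (length U) (length (prescribed cs))) ⟩
    falling (n ∸ length U ∸ suc (length (prescribed cs))) (m ∸ length (prescribed cs)) ∎
    where
    open ≡-Reasoning
    b∉U : b ∉ U
    b∉U b∈U = U#cs (b∈U , here refl)
  count-admissible (suc m) U (nothing ∷ cs) !U !cs U#cs = begin
    #admissible (suc m) U (nothing ∷ cs)
      ≡⟨ #admissible-nothing U cs F (Unique.++⁺ !U !cs U#cs)
           (λ x∉U x∉cs → count-admissible m (_ ∷ U) cs (¬Any⇒All¬ U x∉U ∷ !U) !cs (disjoint-∷ x∉cs U#cs)) ⟩
    (n ∸ length (U ++ prescribed cs)) * F
      ≡⟨ cong₂ (λ a b → a * falling b (m ∸ length (prescribed cs)))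
               (trans (cong (n ∸_) (List.length-++ U)) (sym (∸-+-assoc n (length U) (length (prescribed cs)))))
               (m∸[1+n]∸o≡m∸n∸o∸1 n (length U) (length (prescribed cs))) ⟩
    falling (n ∸ length U ∸ length (prescribed cs)) (suc (m ∸ length (prescribed cs)))
      ≡⟨ cong (falling _) (+-∸-assoc 1 (length-prescribed≤ cs)) ⟨
    falling (n ∸ length U ∸ length (prescribed cs)) (suc m ∸ length (prescribed cs)) ∎
    where
    open ≡-Reasoning
    F : ℕ
    F = falling (n ∸ suc (length U) ∸ length (prescribed cs)) (m ∸ length (prescribed cs))

-- Permutations extending a partial injection

unique-resp-↭ : ∀ {A : Set} {xs ys : List A} → xs ↭ ys → Unique xs → Unique ys
unique-resp-↭ {A} p = Unique-resp-↭ (setoid A) (↭⇒↭ₛ p)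

unique? : ∀ {n} (xs : List (Fin n)) → Dec (Unique xs)
unique? = UniqueDec.unique? _≟ᶠ_

module _ {n : ℕ} where

  free : ∀ m → Vec (Maybe (Fin n)) m
  free m = replicate m nothing

  prescribed-free : ∀ m → prescribed (free m) ≡ []
  prescribed-free zero    = refl
  prescribed-free (suc m) = prescribed-free m

  admissible-free⇔unique : ∀ {m} U (w : Vec (Fin n) m) → Unique U → Admissible U (free m) w ⇔ Unique (U ++ toList w)
  admissible-free⇔unique U []      !U = mk⇔ (λ _ → subst Unique (sym (List.++-identityʳ U)) !U) (λ _ → tt)
  admissible-free⇔unique U (x ∷ w) !U = mk⇔ to from
    where
    to : Admissible U (free _) (x ∷ w) → Unique (U ++ toList (x ∷ w))
    to (x∉U , _ , adm) = unique-resp-↭ (↭-sym (shift x U (toList w)))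
                           (Equivalence.to (admissible-free⇔unique (x ∷ U) w (¬Any⇒All¬ U x∉U ∷ !U)) adm)
    from : Unique (U ++ toList (x ∷ w)) → Admissible U (free _) (x ∷ w)
    from !Uxw = x∉U , tt , Equivalence.from (admissible-free⇔unique (x ∷ U) w (¬Any⇒All¬ U x∉U ∷ !U)) !xUw
      where
      !xUw : Unique (x ∷ U ++ toList w)
      !xUw = unique-resp-↭ (shift x U (toList w)) !Uxw
      x∉U : x ∉ U
      x∉U = Unique.Unique[x∷xs]⇒x∉xs !xUw ∘ ∈-++⁺ˡ

  count-fresh : ∀ m U → Unique U → ∑[ w ∈ allMaps m n ] 𝟙 (unique? (U ++ toList w)) ≡ falling (n ∸ length U) m
  count-fresh m U !U = begin
    ∑[ w ∈ allMaps m n ] 𝟙 (unique? (U ++ toList w))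
      ≡⟨ ∑-cong (allMaps m n) (λ w → 𝟙-cong _ _ (⇔.sym (admissible-free⇔unique U w !U))) ⟩
    #admissible m U (free m)
      ≡⟨ count-admissible m U (free m) !U (subst Unique (sym p) []) (λ (_ , z∈) → ¬Any[] (subst (_ ∈_) p z∈)) ⟩
    falling (n ∸ length U ∸ length (prescribed (free m))) (m ∸ length (prescribed (free m)))
      ≡⟨ cong (λ cs → falling (n ∸ length U ∸ length cs) (m ∸ length cs)) p ⟩
    falling (n ∸ length U) m ∎
    where
    open ≡-Reasoning
    p : prescribed (free m) ≡ []
    p = prescribed-free m

  Matches : ∀ {m} → Vec (Maybe (Fin n)) m → Vec (Fin n) m → Set
  Matches cs w = ∀ t {b} → lookup cs t ≡ just b → lookup w t ≡ b

  admissible⇔free×matches : ∀ {m} U (cs : Vec (Maybe (Fin n)) m) w →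
    Admissible U cs w ⇔ (Admissible U (free m) w × Matches cs w)
  admissible⇔free×matches U cs w = mk⇔ (λ adm → forget U cs w adm , matches U cs w adm) (λ (adm , m) → combine U cs w adm m)
    where
    forget : ∀ {m} U (cs : Vec (Maybe (Fin n)) m) w → Admissible U cs w → Admissible U (free m) w
    forget U []       []      _                 = tt
    forget U (c ∷ cs) (x ∷ w) (x∉U , _ , adm) = x∉U , tt , forget (x ∷ U) cs w adm
    matches : ∀ {m} U (cs : Vec (Maybe (Fin n)) m) w → Admissible U cs w → Matches cs w
    matches U (just b ∷ cs) (x ∷ w) (_ , x≡b , _) zero refl    = x≡b
    matches U (c ∷ cs)      (x ∷ w) (_ , _ , adm) (suc t) cs≡b = matches (x ∷ U) cs w adm t cs≡b
    combine : ∀ {m} U (cs : Vec (Maybe (Fin n)) m) w → Admissible U (free m) w → Matches cs w → Admissible U cs w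
    combine U []             []      _               _ = tt
    combine U (nothing ∷ cs) (x ∷ w) (x∉U , _ , adm) m = x∉U , tt , combine (x ∷ U) cs w adm (m ∘ suc)
    combine U (just b ∷ cs)  (x ∷ w) (x∉U , _ , adm) m = x∉U , m zero refl , combine (x ∷ U) cs w adm (m ∘ suc)

module _ {m n : ℕ} where

  Extends : List (Fin m × Fin n) → Vec (Fin n) m → Set
  Extends P w = All (λ (s , t) → lookup w s ≡ t) P

  extends? : ∀ P w → Dec (Extends P w)
  extends? P w = all? (λ (s , t) → lookup w s ≟ᶠ t) P

  assoc : Fin m → List (Fin m × Fin n) → Maybe (Fin n)
  assoc a []            = nothing
  assoc a ((s , t) ∷ P) with a ≟ᶠ s
  ... | yes _ = just t
  ... | no _  = assoc a P

  assoc≡just⇒∈ : ∀ a P {b} → assoc a P ≡ just b → (a , b) ∈ P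
  assoc≡just⇒∈ a ((s , t) ∷ P) eq with a ≟ᶠ s
  assoc≡just⇒∈ a ((s , t) ∷ P) refl | yes refl = here refl
  ... | no _ = there (assoc≡just⇒∈ a P eq)

  ∈⇒assoc≡just : ∀ {a b} P → Unique (map proj₁ P) → (a , b) ∈ P → assoc a P ≡ just b
  ∈⇒assoc≡just {a} ((s , t) ∷ P) (s∉P ∷ !P) ab∈ with a ≟ᶠ s | ab∈
  ... | yes _    | here refl = refl
  ... | yes refl | there ab∈P = ⊥-elim (All.lookup s∉P (∈-map⁺ proj₁ ab∈P) refl)
  ... | no a≢s   | here refl = ⊥-elim (a≢s refl)
  ... | no _     | there ab∈P = ∈⇒assoc≡just P !P ab∈P

  assoc-is-just⇔∈ : ∀ a P → Is-just (assoc a P) ⇔ a ∈ map proj₁ P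
  assoc-is-just⇔∈ a P = mk⇔ to from
    where
    to : ∀ {P} → Is-just (assoc a P) → a ∈ map proj₁ P
    to {P} j with assoc a P in eq
    to {P} (Maybe.just _) | just b = ∈-map⁺ proj₁ (assoc≡just⇒∈ a P eq)
    from : ∀ {P} → a ∈ map proj₁ P → Is-just (assoc a P)
    from {(s , t) ∷ P} a∈ with a ≟ᶠ s | a∈
    ... | yes _   | _          = Maybe.just tt
    ... | no a≢s  | here a≡s   = ⊥-elim (a≢s a≡s)
    ... | no _    | there a∈P  = from a∈P

  table : List (Fin m × Fin n) → Vec (Maybe (Fin n)) m
  table P = tabulate (λ a → assoc a P)

  matches-table⇔extends : ∀ P w → Unique (map proj₁ P) → Matches (table P) w ⇔ Extends P w
  matches-table⇔extends P w !P = mk⇔ to from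
    where
    to : Matches (table P) w → Extends P w
    to mt = All.tabulate λ {st} st∈P → mt (proj₁ st) (trans (lookup∘tabulate _ (proj₁ st)) (∈⇒assoc≡just P !P st∈P))
    from : Extends P w → Matches (table P) w
    from ext s eq = All.lookup ext (assoc≡just⇒∈ s P (trans (sym (lookup∘tabulate _ s)) eq))

module _ {n : ℕ} where

  is-just? : (c : Maybe (Fin n)) → Dec (Is-just c)
  is-just? = Maybe.dec (λ _ → yes tt)

  ∈-prescribed⁻ : ∀ {m} (cs : Vec (Maybe (Fin n)) m) {b} → b ∈ prescribed cs → ∃ λ t → lookup cs t ≡ just b
  ∈-prescribed⁻ (nothing ∷ cs) b∈ = let t , eq = ∈-prescribed⁻ cs b∈ in suc t , eq
  ∈-prescribed⁻ (just b ∷ cs) (here refl) = zero , refl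
  ∈-prescribed⁻ (just b ∷ cs) (there b∈) = let t , eq = ∈-prescribed⁻ cs b∈ in suc t , eq

  prescribed-unique : ∀ {m} (cs : Vec (Maybe (Fin n)) m) →
    (∀ {s t b} → lookup cs s ≡ just b → lookup cs t ≡ just b → s ≡ t) → Unique (prescribed cs)
  prescribed-unique []             inj = []
  prescribed-unique (nothing ∷ cs) inj = prescribed-unique cs (λ eq₁ eq₂ → Fin.suc-injective (inj eq₁ eq₂))
  prescribed-unique (just b ∷ cs)  inj =
    All.tabulate (λ b∈ b≡ → let t , eq = ∈-prescribed⁻ cs b∈ in Fin.0≢1+n (inj refl (subst (λ z → lookup cs t ≡ just z) (sym b≡) eq)))
    ∷ prescribed-unique cs (λ eq₁ eq₂ → Fin.suc-injective (inj eq₁ eq₂))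

  length-prescribed : ∀ {m} (cs : Vec (Maybe (Fin n)) m) → length (prescribed cs) ≡ ∑[ t ∈ allFin m ] 𝟙 (is-just? (lookup cs t))
  length-prescribed []             = refl
  length-prescribed (nothing ∷ cs) = trans (length-prescribed cs) (sym (∑-allFin-suc (λ t → 𝟙 (is-just? (lookup (nothing ∷ cs) t)))))
  length-prescribed (just b ∷ cs)  = trans (cong suc (length-prescribed cs)) (sym (∑-allFin-suc (λ t → 𝟙 (is-just? (lookup (just b ∷ cs) t)))))

module _ {m n : ℕ} where

  prescribed-table-unique : ∀ (P : List (Fin m × Fin n)) → Unique (map proj₂ P) → Unique (prescribed (table P))
  prescribed-table-unique P !P = prescribed-unique (table P) λ {s} {t} eq₁ eq₂ →
    same-value P !P (assoc≡just⇒∈ s P (trans (sym (lookup∘tabulate _ s)) eq₁)) (assoc≡just⇒∈ t P (trans (sym (lookup∘tabulate _ t)) eq₂))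
    where
    same-value : ∀ P {s t b} → Unique (map proj₂ P) → (s , b) ∈ P → (t , b) ∈ P → s ≡ t
    same-value (_ ∷ P) _            (here refl) (here refl) = refl
    same-value (_ ∷ P) (b∉P ∷ _)   (here refl) (there tb∈) = ⊥-elim (All.lookup b∉P (∈-map⁺ proj₂ tb∈) refl)
    same-value (_ ∷ P) (b∉P ∷ _)   (there sb∈) (here refl) = ⊥-elim (All.lookup b∉P (∈-map⁺ proj₂ sb∈) refl)
    same-value (_ ∷ P) (_ ∷ !P)    (there sb∈) (there tb∈) = same-value P !P sb∈ tb∈

  length-prescribed-table : ∀ (P : List (Fin m × Fin n)) → Unique (map proj₁ P) → length (prescribed (table P)) ≡ length P
  length-prescribed-table P !P = begin
    length (prescribed (table P))                        ≡⟨ length-prescribed (table P) ⟩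
    ∑[ t ∈ allFin m ] 𝟙 (is-just? (lookup (table P) t))  ≡⟨ ∑-cong (allFin m) (λ t → 𝟙-cong _ _ (key t)) ⟩
    ∑[ t ∈ allFin m ] 𝟙 (t ∈? map proj₁ P)               ≡⟨ count-∈ (map proj₁ P) !P ⟩
    length (map proj₁ P)                                 ≡⟨ List.length-map proj₁ P ⟩
    length P                                             ∎
    where
    open ≡-Reasoning
    key : ∀ t → Is-just (lookup (table P) t) ⇔ t ∈ map proj₁ P
    key t = ⇔.trans (subst (λ c → Is-just (lookup (table P) t) ⇔ Is-just c) (lookup∘tabulate _ t) ⇔.refl) (assoc-is-just⇔∈ t P)

count-extensions : ∀ {n} (P : List (Fin n × Fin n)) → Unique (map proj₁ P) → Unique (map proj₂ P) →
  ∑[ π ∈ allMaps n n ] 𝟙 (unique? (toList π)) * 𝟙 (extends? P π) ≡ (n ∸ length P) !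
count-extensions {n} P !keys !values = begin
  ∑[ π ∈ allMaps n n ] 𝟙 (unique? (toList π)) * 𝟙 (extends? P π)
    ≡⟨ ∑-cong (allMaps n n) (λ π → sym (𝟙-× (unique? (toList π)) (extends? P π))) ⟩
  ∑[ π ∈ allMaps n n ] 𝟙 (unique? (toList π) ×-dec extends? P π)
    ≡⟨ ∑-cong (allMaps n n) (λ π → 𝟙-cong _ _ (characterise π)) ⟩
  #admissible n [] (table P)
    ≡⟨ count-admissible n [] (table P) [] (prescribed-table-unique P !values) (λ ()) ⟩
  falling (n ∸ length (prescribed (table P))) (n ∸ length (prescribed (table P)))
    ≡⟨ falling-diag (n ∸ length (prescribed (table P))) ⟩
  (n ∸ length (prescribed (table P))) !
    ≡⟨ cong (λ l → (n ∸ l) !) (length-prescribed-table P !keys) ⟩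
  (n ∸ length P) ! ∎
  where
  open ≡-Reasoning
  characterise : ∀ π → (Unique (toList π) × Extends P π) ⇔ Admissible [] (table P) π
  characterise π = ⇔.sym (⇔.trans (admissible⇔free×matches [] (table P) π)
                                  (admissible-free⇔unique [] π [] ×-⇔ matches-table⇔extends P π !keys))

count-extensions-of-fresh-words : ∀ {n L} c U (P : List (Fin n) → List (Fin n × Fin n)) → Unique U →
  (∀ xs → Unique (U ++ xs) → Unique (map proj₁ (P xs)) × Unique (map proj₂ (P xs)) × length (P xs) ≡ c + length xs) →
  ∑[ π ∈ allMaps n n ] 𝟙 (unique? (toList π)) * (∑[ s ∈ allMaps L n ] 𝟙 (unique? (U ++ toList s)) * 𝟙 (extends? (P (toList s)) π))
    ≡ (n ∸ (c + L)) ! * falling (n ∸ length U) L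
count-extensions-of-fresh-words {n} {L} c U P !U valid = begin
  ∑[ π ∈ Πs ] perm π * (∑[ s ∈ Ss ] fresh s * ext s π)
    ≡⟨ ∑-cong Πs (λ π → sym (∑-*ˡ Ss (perm π) (λ s → fresh s * ext s π))) ⟩
  ∑[ π ∈ Πs ] ∑[ s ∈ Ss ] perm π * (fresh s * ext s π)
    ≡⟨ ∑-comm Πs Ss (λ π s → perm π * (fresh s * ext s π)) ⟩
  ∑[ s ∈ Ss ] ∑[ π ∈ Πs ] perm π * (fresh s * ext s π)
    ≡⟨ ∑-cong Ss (λ s → trans (∑-cong Πs (λ π → *-Semigroup.x∙yz≈y∙xz (perm π) (fresh s) (ext s π)))
                              (∑-*ˡ Πs (fresh s) (λ π → perm π * ext s π))) ⟩
  ∑[ s ∈ Ss ] fresh s * (∑[ π ∈ Πs ] perm π * ext s π)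
    ≡⟨ ∑-cong Ss (λ s → 𝟙-*-cong (unique? (U ++ toList s)) (extensions s)) ⟩
  ∑[ s ∈ Ss ] fresh s * F
    ≡⟨ ∑-*ʳ Ss fresh F ⟨
  (∑[ s ∈ Ss ] fresh s) * F
    ≡⟨ cong (_* F) (count-fresh L U !U) ⟩
  falling (n ∸ length U) L * F
    ≡⟨ *-comm _ F ⟩
  F * falling (n ∸ length U) L ∎
  where
  open ≡-Reasoning
  Πs : List (Vec (Fin n) n)
  Πs = allMaps n n
  Ss : List (Vec (Fin n) L)
  Ss = allMaps L n
  F : ℕ
  F = (n ∸ (c + L)) !
  perm : Vec (Fin n) n → ℕ
  perm π = 𝟙 (unique? (toList π))
  fresh : Vec (Fin n) L → ℕ
  fresh s = 𝟙 (unique? (U ++ toList s))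
  ext : Vec (Fin n) L → Vec (Fin n) n → ℕ
  ext s π = 𝟙 (extends? (P (toList s)) π)
  extensions : ∀ s → Unique (U ++ toList s) → ∑[ π ∈ Πs ] perm π * ext s π ≡ F
  extensions s !Us with valid (toList s) !Us
  ... | !sources , !targets , |P| = trans (count-extensions (P (toList s)) !sources !targets)
                                          (cong (λ l → (n ∸ l) !) (trans |P| (cong (_+_ c) (length-toList s))))

-- Iterates, walks and first return times

module _ {A : Set} (f : A → A) where

  iter-sucʳ : ∀ t x → iter (suc t) f x ≡ iter t f (f x)
  iter-sucʳ zero    x = refl
  iter-sucʳ (suc t) x = cong f (iter-sucʳ t x)

  iter-+ : ∀ a b x → iter (a + b) f x ≡ iter a f (iter b f x)
  iter-+ zero    b x = refl
  iter-+ (suc a) b x = cong f (iter-+ a b x)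

  iter-comm : ∀ a b x → iter a f (iter b f x) ≡ iter b f (iter a f x)
  iter-comm a b x = trans (sym (iter-+ a b x)) (trans (cong (λ t → iter t f x) (+-comm a b)) (iter-+ b a x))

  iter-*-fixed : ∀ q d x → iter d f x ≡ x → iter (q * d) f x ≡ x
  iter-*-fixed zero    d x _ = refl
  iter-*-fixed (suc q) d x fixed = trans (iter-+ d (q * d) x) (trans (cong (iter d f) (iter-*-fixed q d x fixed)) fixed)

  iter-∣-fixed : ∀ {d k} x → d ∣ k → iter d f x ≡ x → iter k f x ≡ x
  iter-∣-fixed x (divides q refl) = iter-*-fixed q _ x

  iter-%-fixed : ∀ e k x .{{_ : NonZero e}} → iter e f x ≡ x → iter k f x ≡ iter (k % e) f x
  iter-%-fixed e k x fixed = begin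
    iter k f x                                 ≡⟨ cong (λ t → iter t f x) (m≡m%n+[m/n]*n k e) ⟩
    iter (k % e + (k / e) * e) f x             ≡⟨ iter-+ (k % e) ((k / e) * e) x ⟩
    iter (k % e) f (iter ((k / e) * e) f x)    ≡⟨ cong (iter (k % e) f) (iter-*-fixed (k / e) e x fixed) ⟩
    iter (k % e) f x                           ∎
    where open ≡-Reasoning

  walk : A → ℕ → List A
  walk x zero    = []
  walk x (suc L) = f x ∷ walk (f x) L

  length-walk : ∀ x L → length (walk x L) ≡ L
  length-walk x zero    = refl
  length-walk x (suc L) = cong suc (length-walk (f x) L)

  walk-+ : ∀ a b x → walk x (a + b) ≡ walk x a ++ walk (iter a f x) b
  walk-+ zero    b x = refl
  walk-+ (suc a) b x = cong (f x ∷_) (trans (walk-+ a b (f x)) (cong (λ z → walk (f x) a ++ walk z b) (sym (iter-sucʳ a x))))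

  walk-snoc : ∀ x L → walk x (suc L) ≡ walk x L ++ [ iter (suc L) f x ]
  walk-snoc x L = trans (cong (walk x) (+-comm 1 L)) (walk-+ L 1 x)

  ∈-walk⁻ : ∀ {L x z} → z ∈ walk x L → ∃ λ t → t < L × z ≡ iter (suc t) f x
  ∈-walk⁻ {suc L}     (here z≡) = 0 , s≤s z≤n , z≡
  ∈-walk⁻ {suc L} {x} (there z∈) with ∈-walk⁻ z∈
  ... | t , t<L , z≡ = suc t , s≤s t<L , trans z≡ (sym (iter-sucʳ (suc t) x))

  ∈-walk⁺ : ∀ {L t} x → t < L → iter (suc t) f x ∈ walk x L
  ∈-walk⁺ {suc L} {zero}  x _         = here refl
  ∈-walk⁺ {suc L} {suc t} x (s≤s t<L) = there (subst (_∈ walk (f x) L) (sym (iter-sucʳ (suc t) x)) (∈-walk⁺ (f x) t<L))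

  walk-∌⇒noReturn : ∀ {L} x → x ∉ walk x L → ∀ {u} → 1 ≤ u → u ≤ L → iter u f x ≢ x
  walk-∌⇒noReturn {L} x x∉ {suc t} _ t<L eq = x∉ (subst (_∈ walk x L) eq (∈-walk⁺ x t<L))

  noReturn⇒walk-∌ : ∀ {L} x → (∀ {u} → 1 ≤ u → u ≤ L → iter u f x ≢ x) → x ∉ walk x L
  noReturn⇒walk-∌ x noReturn x∈ with ∈-walk⁻ x∈
  ... | t , t<L , eq = noReturn (s≤s z≤n) t<L (sym eq)

  module _ (f-injective : Injective _≡_ _≡_ f) where

    iter-injective : ∀ t → Injective _≡_ _≡_ (iter t f)
    iter-injective zero    eq = eq
    iter-injective (suc t) eq = iter-injective t (f-injective eq)

    walk-unique : ∀ {M} x → (∀ {t} → 1 ≤ t → t < M → iter t f x ≢ x) → ∀ {L} → L ≤ M → Unique (walk x L)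
    walk-unique x noReturn {zero}  _     = []
    walk-unique x noReturn {suc L} 1+L≤M = ¬Any⇒All¬ _ fx∉ ∷ walk-unique (f x) noReturn′ (≤-trans (n≤1+n L) 1+L≤M)
      where
      noReturn′ : ∀ {t} → 1 ≤ t → t < _ → iter t f (f x) ≢ f x
      noReturn′ {t} 1≤t t<M eq = noReturn 1≤t t<M (f-injective (trans (iter-sucʳ t x) eq))
      fx∉ : f x ∉ walk (f x) L
      fx∉ fx∈ with ∈-walk⁻ fx∈
      ... | t , t<L , eq = noReturn (s≤s z≤n) (≤-trans (s≤s t<L) 1+L≤M) (sym (trans (f-injective eq) (sym (iter-sucʳ t x))))

    orbits-disjoint : ∀ {k x z} → iter k f x ≡ x → iter k f z ≢ z → ∀ t u → iter t f x ≢ iter u f z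
    orbits-disjoint {k} {x} {z} xFixed zMoves t u eq = zMoves (iter-injective u (begin
      iter u f (iter k f z)   ≡⟨ iter-comm u k z ⟩
      iter k f (iter u f z)   ≡⟨ cong (iter k f) eq ⟨
      iter k f (iter t f x)   ≡⟨ iter-comm k t x ⟩
      iter t f (iter k f x)   ≡⟨ cong (iter t f) xFixed ⟩
      iter t f x              ≡⟨ eq ⟩
      iter u f z              ∎))
      where open ≡-Reasoning

  module _ (_≟_ : DecidableEquality A) where

    IsReturnTime : ℕ → A → ℕ → Set
    IsReturnTime k x d = 1 ≤ d × d ≤ k × iter d f x ≡ x × (∀ {u} → 1 ≤ u → u < d → iter u f x ≢ x)

    NoReturn : ℕ → A → Set
    NoReturn k x = ∀ {u} → 1 ≤ u → u ≤ k → iter u f x ≢ x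

    private
      search : ℕ → ℕ → A → Maybe ℕ
      search t zero    x = nothing
      search t (suc r) x with iter t f x ≟ x
      ... | yes _ = just t
      ... | no _  = search (suc t) r x

      search-just : ∀ t r x {d} → search t r x ≡ just d →
        t ≤ d × d < t + r × iter d f x ≡ x × (∀ {u} → t ≤ u → u < d → iter u f x ≢ x)
      search-just t (suc r) x {d} eq with iter t f x ≟ x
      search-just t (suc r) x refl | yes fixed = ≤-refl , m<m+n t (s≤s z≤n) , fixed , λ t≤u u<t → ⊥-elim (<-irrefl refl (≤-<-trans t≤u u<t))
      ... | no moves with search-just (suc t) r x eq
      ... | t<d , d<t+r , fixed , before = <⇒≤ t<d , subst (d <_) (sym (+-suc t r)) d<t+r , fixed , before′
        where
        before′ : ∀ {u} → t ≤ u → u < _ → iter u f x ≢ x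
        before′ t≤u u<d with m≤n⇒m<n∨m≡n t≤u
        ... | inj₁ t<u  = before t<u u<d
        ... | inj₂ refl = moves

      search-nothing : ∀ t r x → search t r x ≡ nothing → ∀ {u} → t ≤ u → u < t + r → iter u f x ≢ x
      search-nothing t zero    x _  t≤u u<t = ⊥-elim (<-irrefl refl (≤-<-trans t≤u (subst (_ <_) (+-identityʳ t) u<t)))
      search-nothing t (suc r) x eq {u} t≤u u<t+r with iter t f x ≟ x
      ... | no moves with m≤n⇒m<n∨m≡n t≤u
      ...   | inj₂ refl = moves
      ...   | inj₁ t<u  = search-nothing (suc t) r x eq t<u (subst (u <_) (+-suc t r) u<t+r)

    returnTime : ℕ → A → Maybe ℕ
    returnTime k x = search 1 k x

    returnTime-just⇒ : ∀ {k x d} → returnTime k x ≡ just d → IsReturnTime k x d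
    returnTime-just⇒ {k} {x} eq with search-just 1 k x eq
    ... | 1≤d , s≤s d≤k , fixed , before = 1≤d , d≤k , fixed , before

    returnTime-nothing⇒ : ∀ {k x} → returnTime k x ≡ nothing → NoReturn k x
    returnTime-nothing⇒ {k} {x} eq 1≤u u≤k = search-nothing 1 k x eq 1≤u (s≤s u≤k)

    returnTime-unique : ∀ {k x d e} → IsReturnTime k x d → IsReturnTime k x e → d ≡ e
    returnTime-unique {d = d} {e} (1≤d , _ , dFixed , dFirst) (1≤e , _ , eFixed , eFirst) with <-cmp d e
    ... | tri< d<e _ _ = ⊥-elim (eFirst 1≤d d<e dFixed)
    ... | tri≈ _ d≡e _ = d≡e
    ... | tri> _ _ e<d = ⊥-elim (dFirst 1≤e e<d eFixed)

    returnTime-just⇐ : ∀ {k x d} → IsReturnTime k x d → returnTime k x ≡ just d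
    returnTime-just⇐ {k} {x} isRet@(1≤d , d≤k , fixed , _) with returnTime k x in eq
    ... | nothing = ⊥-elim (returnTime-nothing⇒ eq 1≤d d≤k fixed)
    ... | just d′ = cong just (returnTime-unique (returnTime-just⇒ eq) isRet)

    returnTime-nothing⇐ : ∀ {k x} → NoReturn k x → returnTime k x ≡ nothing
    returnTime-nothing⇐ {k} {x} noRet with returnTime k x in eq
    ... | nothing = refl
    ... | just d with returnTime-just⇒ eq
    ...   | 1≤d , d≤k , fixed , _ = ⊥-elim (noRet 1≤d d≤k fixed)

    isReturnTime-walk : ∀ {k L} x → suc L ≤ k → iter (suc L) f x ≡ x → x ∉ walk x L → IsReturnTime k x (suc L)
    isReturnTime-walk x L<k fixed x∉ = s≤s z≤n , L<k , fixed , λ 1≤u u<1+L → walk-∌⇒noReturn x x∉ 1≤u (s≤s⁻¹ u<1+L)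

    returnTime-∣ : ∀ {k x d} → IsReturnTime k x d → iter k f x ≡ x → d ∣ k
    returnTime-∣ {k} {x} {suc d} (_ , _ , fixed , first) kFixed = m%n≡0⇒n∣m k (suc d) (remainder-zero (k % suc d) refl)
      where
      remainder-zero : ∀ r → k % suc d ≡ r → r ≡ 0
      remainder-zero zero    _  = refl
      remainder-zero (suc r) eq = ⊥-elim (first (s≤s z≤n) (subst (_< suc d) eq (m%n<n k (suc d)))
                                           (subst (λ t → iter t f x ≡ x) eq (trans (sym (iter-%-fixed (suc d) k x fixed)) kFixed)))

module _ {A : Set} where

  length-∷ʳ : ∀ (xs : List A) x → length (xs ∷ʳ x) ≡ suc (length xs)
  length-∷ʳ xs x = trans (List.length-++ xs) (+-comm (length xs) 1)

  take-length : ∀ m {l} (xs : List A) → length xs ≡ m + l → length (take m xs) ≡ m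
  take-length m xs |xs| = trans (List.length-take m xs) (trans (cong (m ⊓_) |xs|) (m≤n⇒m⊓n≡m (m≤m+n m _)))

  drop-length : ∀ m {l} (xs : List A) → length xs ≡ m + l → length (drop m xs) ≡ l
  drop-length m xs |xs| = trans (List.length-drop m xs) (trans (cong (_∸ m) |xs|) (m+n∸m≡n m _))

  ++-injective : ∀ (xs xs′ : List A) {ys ys′} → length xs ≡ length xs′ → xs ++ ys ≡ xs′ ++ ys′ → xs ≡ xs′ × ys ≡ ys′
  ++-injective []       []         _   eq = refl , eq
  ++-injective (x ∷ xs) (x′ ∷ xs′) |xs| eq with List.∷-injective eq
  ... | refl , eq′ with ++-injective xs xs′ (suc-injective |xs|) eq′
  ... | refl , ys≡ = refl , ys≡

  two-blocks-↭ : ∀ a b (as bs : List A) → (a ∷ as) ++ (b ∷ bs) ↭ a ∷ b ∷ as ++ bs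
  two-blocks-↭ a b as bs = prep a (shift b as bs)

  three-blocks-↭ : ∀ a b c (as bs cs : List A) → (a ∷ as) ++ (b ∷ bs) ++ (c ∷ cs) ↭ a ∷ b ∷ c ∷ as ++ bs ++ cs
  three-blocks-↭ a b c as bs cs = prep a (begin
    as ++ b ∷ bs ++ c ∷ cs       ↭⟨ shift b as _ ⟩
    b ∷ as ++ bs ++ c ∷ cs       ≡⟨ cong (b ∷_) (List.++-assoc as bs (c ∷ cs)) ⟨
    b ∷ (as ++ bs) ++ c ∷ cs     ↭⟨ prep b (shift c (as ++ bs) cs) ⟩
    b ∷ c ∷ (as ++ bs) ++ cs     ≡⟨ cong (λ l → b ∷ c ∷ l) (List.++-assoc as bs cs) ⟩
    b ∷ c ∷ as ++ bs ++ cs       ∎)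
    where open PermutationReasoning

  snoc-blocks₂-↭ : ∀ a b (as bs : List A) → (as ∷ʳ a) ++ (bs ∷ʳ b) ↭ a ∷ b ∷ as ++ bs
  snoc-blocks₂-↭ a b as bs = ↭-trans (++⁺ (↭-sym (∷↭∷ʳ a as)) (↭-sym (∷↭∷ʳ b bs))) (two-blocks-↭ a b as bs)

  snoc-blocks₃-↭ : ∀ a b c (as bs cs : List A) → (as ∷ʳ a) ++ (bs ∷ʳ b) ++ (cs ∷ʳ c) ↭ a ∷ b ∷ c ∷ as ++ bs ++ cs
  snoc-blocks₃-↭ a b c as bs cs =
    ↭-trans (++⁺ (↭-sym (∷↭∷ʳ a as)) (++⁺ (↭-sym (∷↭∷ʳ b bs)) (↭-sym (∷↭∷ʳ c cs)))) (three-blocks-↭ a b c as bs cs)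

module _ {n : ℕ} where

  chain : Fin n → List (Fin n) → List (Fin n × Fin n)
  chain x []       = []
  chain x (z ∷ zs) = (x , z) ∷ chain z zs

  arc : Fin n → List (Fin n) → Fin n → List (Fin n × Fin n)
  arc x zs z = chain x (zs ∷ʳ z)

  sources-arc : ∀ x zs z → map proj₁ (arc x zs z) ≡ x ∷ zs
  sources-arc x []       z = refl
  sources-arc x (w ∷ zs) z = cong (x ∷_) (sources-arc w zs z)

  targets-arc : ∀ x zs z → map proj₂ (arc x zs z) ≡ zs ∷ʳ z
  targets-arc x []       z = refl
  targets-arc x (w ∷ zs) z = cong (w ∷_) (targets-arc w zs z)

  extends-chain⇔ : ∀ (π : Vec (Fin n) n) x zs → Extends (chain x zs) π ⇔ zs ≡ walk (lookup π) x (length zs)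
  extends-chain⇔ π x zs = mk⇔ (to x zs) (from x zs)
    where
    to : ∀ x zs → Extends (chain x zs) π → zs ≡ walk (lookup π) x (length zs)
    to x []       _           = refl
    to x (z ∷ zs) (refl ∷ ext) = cong (lookup π x ∷_) (to (lookup π x) zs ext)
    from : ∀ x zs → zs ≡ walk (lookup π) x (length zs) → Extends (chain x zs) π
    from x []       _  = []
    from x (z ∷ zs) eq with List.∷-injective eq
    ... | refl , eq′ = refl ∷ from z zs eq′

  extends-arc⇔ : ∀ (π : Vec (Fin n) n) x zs z {L} → length zs ≡ L →
    Extends (arc x zs z) π ⇔ (zs ≡ walk (lookup π) x L × iter (suc L) (lookup π) x ≡ z)
  extends-arc⇔ π x zs z refl = ⇔.trans (extends-chain⇔ π x (zs ∷ʳ z)) (mk⇔ to from)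
    where
    f : Fin n → Fin n
    f = lookup π
    walk-snoc′ : walk f x (length (zs ∷ʳ z)) ≡ walk f x (length zs) ∷ʳ iter (suc (length zs)) f x
    walk-snoc′ = trans (cong (walk f x) (length-∷ʳ zs z)) (walk-snoc f x (length zs))
    to : zs ∷ʳ z ≡ walk f x (length (zs ∷ʳ z)) → zs ≡ walk f x (length zs) × iter (suc (length zs)) f x ≡ z
    to eq with List.∷ʳ-injective zs _ (trans eq walk-snoc′)
    ... | zs≡ , z≡ = zs≡ , sym z≡
    from : zs ≡ walk f x (length zs) × iter (suc (length zs)) f x ≡ z → zs ∷ʳ z ≡ walk f x (length (zs ∷ʳ z))
    from (zs≡ , z≡) = trans (cong₂ _∷ʳ_ zs≡ (sym z≡)) (sym walk-snoc′)

-- Cycle and path shapes through i, j and y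

infix 4 _≟ᵐ_
_≟ᵐ_ : (m m′ : Maybe ℕ) → Dec (m ≡ m′)
_≟ᵐ_ = Maybe.≡-dec _≟_

module Shapes {n : ℕ} (k : ℕ) (i j y : Fin n) (y≢j : y ≢ j) where

  module Split (la : ℕ) (xs : List (Fin n)) where
    I J : List (Fin n)
    I = take la xs
    J = drop la xs

  module Split₃ (la lb₁ : ℕ) (xs : List (Fin n)) where
    open Split la xs public using (I)
    J₁ J₂ : List (Fin n)
    J₁ = take lb₁ (Split.J la xs)
    J₂ = drop lb₁ (Split.J la xs)

  split≡ : ∀ la xs → xs ≡ Split.I la xs ++ Split.J la xs
  split≡ la xs = sym (List.take++drop≡id la xs)

  split₃≡ : ∀ la lb₁ xs → xs ≡ Split₃.I la lb₁ xs ++ Split₃.J₁ la lb₁ xs ++ Split₃.J₂ la lb₁ xs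
  split₃≡ la lb₁ xs = trans (split≡ la xs) (cong (take la xs ++_) (split≡ lb₁ (drop la xs)))

  -- The word xs = I ++ J₁ ++ J₂ fills the cycles i → I → i and j → J₁ → y → J₂ → j.
  cyclePairs : ℕ → ℕ → List (Fin n) → List (Fin n × Fin n)
  cyclePairs la lb₁ xs = arc i I i ++ arc j J₁ y ++ arc y J₂ j
    where open Split₃ la lb₁ xs

  -- The word xs = I ++ J fills the cycle i → I → i and the path j → J → y.
  pathPairs : ℕ → List (Fin n) → List (Fin n × Fin n)
  pathPairs la xs = arc i I i ++ arc j J y
    where open Split la xs

  cycle-sources : ∀ la lb₁ xs → map proj₁ (cyclePairs la lb₁ xs) ↭ i ∷ j ∷ y ∷ xs
  cycle-sources la lb₁ xs = begin
    map proj₁ (arc i I i ++ arc j J₁ y ++ arc y J₂ j)  ≡⟨ List.map-++ proj₁ (arc i I i) _ ⟩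
    map proj₁ (arc i I i) ++ map proj₁ (arc j J₁ y ++ arc y J₂ j)
      ≡⟨ cong₂ _++_ (sources-arc i I i) (trans (List.map-++ proj₁ (arc j J₁ y) _) (cong₂ _++_ (sources-arc j J₁ y) (sources-arc y J₂ j))) ⟩
    (i ∷ I) ++ (j ∷ J₁) ++ (y ∷ J₂)                  ↭⟨ three-blocks-↭ i j y I J₁ J₂ ⟩
    i ∷ j ∷ y ∷ I ++ J₁ ++ J₂                        ≡⟨ cong (λ l → i ∷ j ∷ y ∷ l) (split₃≡ la lb₁ xs) ⟨
    i ∷ j ∷ y ∷ xs                                   ∎
    where
    open Split₃ la lb₁ xs
    open PermutationReasoning

  cycle-targets : ∀ la lb₁ xs → map proj₂ (cyclePairs la lb₁ xs) ↭ i ∷ y ∷ j ∷ xs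
  cycle-targets la lb₁ xs = begin
    map proj₂ (arc i I i ++ arc j J₁ y ++ arc y J₂ j)  ≡⟨ List.map-++ proj₂ (arc i I i) _ ⟩
    map proj₂ (arc i I i) ++ map proj₂ (arc j J₁ y ++ arc y J₂ j)
      ≡⟨ cong₂ _++_ (targets-arc i I i) (trans (List.map-++ proj₂ (arc j J₁ y) _) (cong₂ _++_ (targets-arc j J₁ y) (targets-arc y J₂ j))) ⟩
    (I ∷ʳ i) ++ (J₁ ∷ʳ y) ++ (J₂ ∷ʳ j)               ↭⟨ snoc-blocks₃-↭ i y j I J₁ J₂ ⟩
    i ∷ y ∷ j ∷ I ++ J₁ ++ J₂                        ≡⟨ cong (λ l → i ∷ y ∷ j ∷ l) (split₃≡ la lb₁ xs) ⟨
    i ∷ y ∷ j ∷ xs                                   ∎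
    where
    open Split₃ la lb₁ xs
    open PermutationReasoning

  path-sources : ∀ la xs → map proj₁ (pathPairs la xs) ↭ i ∷ j ∷ xs
  path-sources la xs = begin
    map proj₁ (arc i I i ++ arc j J y)               ≡⟨ List.map-++ proj₁ (arc i I i) _ ⟩
    map proj₁ (arc i I i) ++ map proj₁ (arc j J y)   ≡⟨ cong₂ _++_ (sources-arc i I i) (sources-arc j J y) ⟩
    (i ∷ I) ++ (j ∷ J)                               ↭⟨ two-blocks-↭ i j I J ⟩
    i ∷ j ∷ I ++ J                                   ≡⟨ cong (λ l → i ∷ j ∷ l) (split≡ la xs) ⟨
    i ∷ j ∷ xs                                       ∎
    where
    open Split la xs
    open PermutationReasoning

  path-targets : ∀ la xs → map proj₂ (pathPairs la xs) ↭ i ∷ y ∷ xs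
  path-targets la xs = begin
    map proj₂ (arc i I i ++ arc j J y)               ≡⟨ List.map-++ proj₂ (arc i I i) _ ⟩
    map proj₂ (arc i I i) ++ map proj₂ (arc j J y)   ≡⟨ cong₂ _++_ (targets-arc i I i) (targets-arc j J y) ⟩
    (I ∷ʳ i) ++ (J ∷ʳ y)                             ↭⟨ snoc-blocks₂-↭ i y I J ⟩
    i ∷ y ∷ I ++ J                                   ≡⟨ cong (λ l → i ∷ y ∷ l) (split≡ la xs) ⟨
    i ∷ y ∷ xs                                       ∎
    where
    open Split la xs
    open PermutationReasoning

  cycle-valid : ∀ la lb₁ xs → Unique (i ∷ j ∷ y ∷ xs) →
    Unique (map proj₁ (cyclePairs la lb₁ xs)) × Unique (map proj₂ (cyclePairs la lb₁ xs)) × length (cyclePairs la lb₁ xs) ≡ 3 + length xs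
  cycle-valid la lb₁ xs !ijyxs =
    unique-resp-↭ (↭-sym (cycle-sources la lb₁ xs)) !ijyxs ,
    unique-resp-↭ (↭-sym (cycle-targets la lb₁ xs)) (unique-resp-↭ (prep i (swap j y ↭-refl)) !ijyxs) ,
    trans (sym (List.length-map proj₁ (cyclePairs la lb₁ xs))) (↭-length (cycle-sources la lb₁ xs))

  path-valid : ∀ la xs → Unique (i ∷ j ∷ y ∷ xs) →
    Unique (map proj₁ (pathPairs la xs)) × Unique (map proj₂ (pathPairs la xs)) × length (pathPairs la xs) ≡ 2 + length xs
  path-valid la xs !ijyxs =
    unique-resp-↭ (↭-sym (path-sources la xs)) (AllPairs.tail (unique-resp-↭ (↭-trans (prep i (swap j y ↭-refl)) (swap i y ↭-refl)) !ijyxs)) ,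
    unique-resp-↭ (↭-sym (path-targets la xs)) (AllPairs.tail (unique-resp-↭ (swap i j ↭-refl) !ijyxs)) ,
    trans (sym (List.length-map proj₁ (pathPairs la xs))) (↭-length (path-sources la xs))

  module Orbit (π : Vec (Fin n) n) where

    f : Fin n → Fin n
    f = lookup π

    ret : Fin n → Maybe ℕ
    ret = returnTime f _≟ᶠ_ k

    Condition : ℕ → Maybe ℕ → Set
    Condition d m = ret i ≡ just d × ret j ≡ m × iter k f j ≡ y

    condition? : ∀ d m → Dec (Condition d m)
    condition? d m = ret i ≟ᵐ just d ×-dec (ret j ≟ᵐ m ×-dec iter k f j ≟ᶠ y)

    CycleClosed : ℕ → ℕ → ℕ → Set
    CycleClosed la lb₁ lb₂ = iter (suc la) f i ≡ i × iter (suc lb₁) f j ≡ y × iter (suc lb₂) f y ≡ j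

    PathClosed : ℕ → ℕ → Set
    PathClosed la lb = iter (suc la) f i ≡ i × iter (suc lb) f j ≡ y

    cycleWalk : ℕ → ℕ → ℕ → List (Fin n)
    cycleWalk la lb₁ lb₂ = walk f i la ++ walk f j lb₁ ++ walk f y lb₂

    pathWalk : ℕ → ℕ → List (Fin n)
    pathWalk la lb = walk f i la ++ walk f j lb

    cycle-extends⇔ : ∀ la lb₁ lb₂ xs → length xs ≡ la + (lb₁ + lb₂) →
      Extends (cyclePairs la lb₁ xs) π ⇔ (xs ≡ cycleWalk la lb₁ lb₂ × CycleClosed la lb₁ lb₂)
    cycle-extends⇔ la lb₁ lb₂ xs |xs| = mk⇔ to from
      where
      open Split₃ la lb₁ xs
      |I| : length I ≡ la
      |I| = take-length la xs |xs|
      |J| : length (drop la xs) ≡ lb₁ + lb₂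
      |J| = drop-length la xs |xs|
      |J₁| : length J₁ ≡ lb₁
      |J₁| = take-length lb₁ (drop la xs) |J|
      |J₂| : length J₂ ≡ lb₂
      |J₂| = drop-length lb₁ (drop la xs) |J|
      to : Extends (cyclePairs la lb₁ xs) π → xs ≡ cycleWalk la lb₁ lb₂ × CycleClosed la lb₁ lb₂
      to ext with All.++⁻ (arc i I i) ext
      ... | extI , extJ with All.++⁻ (arc j J₁ y) extJ
      ... | extJ₁ , extJ₂ with Equivalence.to (extends-arc⇔ π i I i |I|) extI
                             | Equivalence.to (extends-arc⇔ π j J₁ y |J₁|) extJ₁
                             | Equivalence.to (extends-arc⇔ π y J₂ j |J₂|) extJ₂
      ... | I≡ , closeI | J₁≡ , closeY | J₂≡ , closeJ =
        trans (split₃≡ la lb₁ xs) (cong₂ _++_ I≡ (cong₂ _++_ J₁≡ J₂≡)) , closeI , closeY , closeJ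
      from : xs ≡ cycleWalk la lb₁ lb₂ × CycleClosed la lb₁ lb₂ → Extends (cyclePairs la lb₁ xs) π
      from (xs≡ , closeI , closeY , closeJ)
        with ++-injective I (walk f i la) (trans |I| (sym (length-walk f i la))) (trans (sym (split₃≡ la lb₁ xs)) xs≡)
      ... | I≡ , J≡ with ++-injective J₁ (walk f j lb₁) (trans |J₁| (sym (length-walk f j lb₁))) J≡
      ... | J₁≡ , J₂≡ =
        All.++⁺ (Equivalence.from (extends-arc⇔ π i I i |I|) (I≡ , closeI))
                (All.++⁺ (Equivalence.from (extends-arc⇔ π j J₁ y |J₁|) (J₁≡ , closeY))
                         (Equivalence.from (extends-arc⇔ π y J₂ j |J₂|) (J₂≡ , closeJ)))

    path-extends⇔ : ∀ la lb xs → length xs ≡ la + lb →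
      Extends (pathPairs la xs) π ⇔ (xs ≡ pathWalk la lb × PathClosed la lb)
    path-extends⇔ la lb xs |xs| = mk⇔ to from
      where
      open Split la xs
      |I| : length I ≡ la
      |I| = take-length la xs |xs|
      |J| : length J ≡ lb
      |J| = drop-length la xs |xs|
      to : Extends (pathPairs la xs) π → xs ≡ pathWalk la lb × PathClosed la lb
      to ext with All.++⁻ (arc i I i) ext
      ... | extI , extJ with Equivalence.to (extends-arc⇔ π i I i |I|) extI | Equivalence.to (extends-arc⇔ π j J y |J|) extJ
      ... | I≡ , closeI | J≡ , closeY = trans (split≡ la xs) (cong₂ _++_ I≡ J≡) , closeI , closeY
      from : xs ≡ pathWalk la lb × PathClosed la lb → Extends (pathPairs la xs) π
      from (xs≡ , closeI , closeY) with ++-injective I (walk f i la) (trans |I| (sym (length-walk f i la))) (trans (sym (split≡ la xs)) xs≡)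
      ... | I≡ , J≡ = All.++⁺ (Equivalence.from (extends-arc⇔ π i I i |I|) (I≡ , closeI))
                              (Equivalence.from (extends-arc⇔ π j J y |J|) (J≡ , closeY))

    private
      returnTime-of-walk : ∀ {x L} → suc L ≤ k → iter (suc L) f x ≡ x → x ∉ walk f x L → ret x ≡ just (suc L)
      returnTime-of-walk {x} L<k fixed x∉ = returnTime-just⇐ f _≟ᶠ_ (isReturnTime-walk f _≟ᶠ_ x L<k fixed x∉)

    cycle-walk-j : ∀ lb₁ lb₂ → iter (suc lb₁) f j ≡ y → walk f j (suc lb₁ + lb₂) ≡ (walk f j lb₁ ∷ʳ y) ++ walk f y lb₂
    cycle-walk-j lb₁ lb₂ closeY =
      trans (walk-+ f (suc lb₁) lb₂ j)
            (cong₂ _++_ (trans (walk-snoc f j lb₁) (cong (walk f j lb₁ ∷ʳ_) closeY)) (cong (λ z → walk f z lb₂) closeY))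

    cycle-period : ∀ lb₁ lb₂ → iter (suc lb₁) f j ≡ y → iter (suc lb₂) f y ≡ j → iter (suc lb₁ + suc lb₂) f j ≡ j
    cycle-period lb₁ lb₂ closeY closeJ = begin
      iter (suc lb₁ + suc lb₂) f j           ≡⟨ cong (λ t → iter t f j) (+-comm (suc lb₁) (suc lb₂)) ⟩
      iter (suc lb₂ + suc lb₁) f j           ≡⟨ iter-+ f (suc lb₂) (suc lb₁) j ⟩
      iter (suc lb₂) f (iter (suc lb₁) f j)  ≡⟨ cong (iter (suc lb₂) f) closeY ⟩
      iter (suc lb₂) f y                     ≡⟨ closeJ ⟩
      j                                      ∎
      where open ≡-Reasoning

    cycle-condition⁺ : ∀ {la lb₁ lb₂} → suc la ≤ k → suc lb₁ + suc lb₂ ≤ k → k % (suc lb₁ + suc lb₂) ≡ suc lb₁ →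
      Unique (i ∷ j ∷ y ∷ cycleWalk la lb₁ lb₂) → CycleClosed la lb₁ lb₂ → Condition (suc la) (just (suc lb₁ + suc lb₂))
    cycle-condition⁺ {la} {lb₁} {lb₂} d≤k e≤k k%e≡ !ijyW (closeI , closeY , closeJ) =
      returnTime-of-walk d≤k closeI (λ i∈ → i∉ (there (there (∈-++⁺ˡ i∈)))) ,
      subst (λ e → ret j ≡ just e) (sym (+-suc (suc lb₁) lb₂))
            (returnTime-of-walk (subst (_≤ k) (+-suc (suc lb₁) lb₂) e≤k)
                                (subst (λ e → iter e f j ≡ j) (+-suc (suc lb₁) lb₂) period) j∉walk) ,
      (begin
        iter k f j                          ≡⟨ iter-%-fixed f (suc lb₁ + suc lb₂) k j period ⟩
        iter (k % (suc lb₁ + suc lb₂)) f j  ≡⟨ cong (λ t → iter t f j) k%e≡ ⟩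
        iter (suc lb₁) f j                  ≡⟨ closeY ⟩
        y                                   ∎)
      where
      open ≡-Reasoning
      period : iter (suc lb₁ + suc lb₂) f j ≡ j
      period = cycle-period lb₁ lb₂ closeY closeJ
      i∉ : i ∉ j ∷ y ∷ cycleWalk la lb₁ lb₂
      i∉ = Unique.Unique[x∷xs]⇒x∉xs !ijyW
      j∉ : j ∉ y ∷ cycleWalk la lb₁ lb₂
      j∉ = Unique.Unique[x∷xs]⇒x∉xs (AllPairs.tail !ijyW)
      j∉walk : j ∉ walk f j (suc lb₁ + lb₂)
      j∉walk j∈ with ∈-++⁻ (walk f j lb₁ ∷ʳ y) (subst (j ∈_) (cycle-walk-j lb₁ lb₂ closeY) j∈)
      ... | inj₂ j∈J₂ = j∉ (there (∈-++⁺ʳ (walk f i la) (∈-++⁺ʳ (walk f j lb₁) j∈J₂)))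
      ... | inj₁ j∈J₁y with ∈-++⁻ (walk f j lb₁) j∈J₁y
      ...   | inj₁ j∈J₁        = j∉ (there (∈-++⁺ʳ (walk f i la) (∈-++⁺ˡ j∈J₁)))
      ...   | inj₂ (here j≡y) = y≢j (sym j≡y)

    path-condition⁺ : ∀ {la lb} → suc la ≤ k → k ≡ suc lb →
      Unique (i ∷ j ∷ y ∷ pathWalk la lb) → PathClosed la lb → Condition (suc la) nothing
    path-condition⁺ {la} {lb} d≤k k≡ !ijyW (closeI , closeY) =
      returnTime-of-walk d≤k closeI (λ i∈ → i∉ (there (there (∈-++⁺ˡ i∈)))) ,
      returnTime-nothing⇐ f _≟ᶠ_ (subst (λ t → NoReturn f _≟ᶠ_ t j) (sym k≡) (walk-∌⇒noReturn f j j∉walk)) ,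
      trans (cong (λ t → iter t f j) k≡) closeY
      where
      i∉ : i ∉ j ∷ y ∷ pathWalk la lb
      i∉ = Unique.Unique[x∷xs]⇒x∉xs !ijyW
      j∉ : j ∉ y ∷ pathWalk la lb
      j∉ = Unique.Unique[x∷xs]⇒x∉xs (AllPairs.tail !ijyW)
      j∉walk : j ∉ walk f j (suc lb)
      j∉walk j∈ with ∈-++⁻ (walk f j lb) (subst (j ∈_) (trans (walk-snoc f j lb) (cong (walk f j lb ∷ʳ_) closeY)) j∈)
      ... | inj₁ j∈J        = j∉ (there (∈-++⁺ʳ (walk f i la) j∈J))
      ... | inj₂ (here j≡y) = y≢j (sym j≡y)

    module Reconstruction (f-injective : Injective _≡_ _≡_ f) {la : ℕ} (d∣k : suc la ∣ k)
                          (ret-i : ret i ≡ just (suc la)) (jk≡y : iter k f j ≡ y) where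

      closeI : iter (suc la) f i ≡ i
      closeI = proj₁ (proj₂ (proj₂ (returnTime-just⇒ f _≟ᶠ_ {k} ret-i)))

      walk-i-unique : Unique (walk f i (suc la))
      walk-i-unique = walk-unique f f-injective i (proj₂ (proj₂ (proj₂ (returnTime-just⇒ f _≟ᶠ_ {k} ret-i)))) ≤-refl

      walk-i-snoc : walk f i (suc la) ≡ walk f i la ∷ʳ i
      walk-i-snoc = trans (walk-snoc f i la) (cong (walk f i la ∷ʳ_) closeI)

      orbit-i∌orbit-j : ∀ {L u z} → z ∈ walk f i L → z ≢ iter u f j
      orbit-i∌orbit-j {u = u} z∈ z≡ with ∈-walk⁻ f z∈
      ... | t , _ , z≡t = orbits-disjoint f f-injective {k} (iter-∣-fixed f i d∣k closeI) (λ jk≡j → y≢j (trans (sym jk≡y) jk≡j))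
                                         (suc t) u (trans (sym z≡t) z≡)

      walk-i∩walk-j : ∀ {L L′} → Disjoint (walk f i L) (walk f j L′)
      walk-i∩walk-j (z∈i , z∈j) with ∈-walk⁻ f z∈j
      ... | u , _ , z≡ = orbit-i∌orbit-j {u = suc u} z∈i z≡

      cycle-condition⁻ : ∀ {lb₁ lb₂} → k % (suc lb₁ + suc lb₂) ≡ suc lb₁ → ret j ≡ just (suc lb₁ + suc lb₂) →
        CycleClosed la lb₁ lb₂ × Unique (i ∷ j ∷ y ∷ cycleWalk la lb₁ lb₂)
      cycle-condition⁻ {lb₁} {lb₂} k%e≡ ret-j = (closeI , closeY , closeJ) , unique-resp-↭ arrange (subst Unique targets≡ targets-unique)
        where
        e : ℕ
        e = suc lb₁ + suc lb₂
        isRet-j : IsReturnTime f _≟ᶠ_ k j e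
        isRet-j = returnTime-just⇒ f _≟ᶠ_ {k} ret-j
        period : iter e f j ≡ j
        period = proj₁ (proj₂ (proj₂ isRet-j))
        closeY : iter (suc lb₁) f j ≡ y
        closeY = trans (cong (λ t → iter t f j) (sym k%e≡)) (trans (sym (iter-%-fixed f e k j period)) jk≡y)
        closeJ : iter (suc lb₂) f y ≡ j
        closeJ = begin
          iter (suc lb₂) f y                     ≡⟨ cong (iter (suc lb₂) f) closeY ⟨
          iter (suc lb₂) f (iter (suc lb₁) f j)  ≡⟨ iter-+ f (suc lb₂) (suc lb₁) j ⟨
          iter (suc lb₂ + suc lb₁) f j           ≡⟨ cong (λ t → iter t f j) (+-comm (suc lb₂) (suc lb₁)) ⟩
          iter e f j                             ≡⟨ period ⟩
          j                                      ∎
          where open ≡-Reasoning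
        targets-unique : Unique (walk f i (suc la) ++ walk f j e)
        targets-unique = Unique.++⁺ walk-i-unique (walk-unique f f-injective j (proj₂ (proj₂ (proj₂ isRet-j))) ≤-refl) walk-i∩walk-j
        targets≡ : walk f i (suc la) ++ walk f j e ≡ (walk f i la ∷ʳ i) ++ (walk f j lb₁ ∷ʳ y) ++ (walk f y lb₂ ∷ʳ j)
        targets≡ = cong₂ _++_ walk-i-snoc (trans (walk-+ f (suc lb₁) (suc lb₂) j)
          (cong₂ _++_ (trans (walk-snoc f j lb₁) (cong (walk f j lb₁ ∷ʳ_) closeY))
                      (trans (walk-snoc f _ lb₂) (cong₂ (λ z w → walk f z lb₂ ∷ʳ w) closeY (trans (cong (iter (suc lb₂) f) closeY) closeJ)))))
        arrange : (walk f i la ∷ʳ i) ++ (walk f j lb₁ ∷ʳ y) ++ (walk f y lb₂ ∷ʳ j) ↭ i ∷ j ∷ y ∷ cycleWalk la lb₁ lb₂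
        arrange = ↭-trans (snoc-blocks₃-↭ i y j (walk f i la) (walk f j lb₁) (walk f y lb₂)) (prep i (swap y j ↭-refl))

      path-condition⁻ : ∀ {lb} → k ≡ suc lb → ret j ≡ nothing → PathClosed la lb × Unique (i ∷ j ∷ y ∷ pathWalk la lb)
      path-condition⁻ {lb} k≡ ret-j = (closeI , closeY) , unique-resp-↭ arrange (subst (λ l → Unique (j ∷ l)) targets≡ j∷targets-unique)
        where
        noReturn : ∀ {u} → 1 ≤ u → u ≤ suc lb → iter u f j ≢ j
        noReturn 1≤u u≤ = returnTime-nothing⇒ f _≟ᶠ_ {k} ret-j 1≤u (subst (_ ≤_) (sym k≡) u≤)
        closeY : iter (suc lb) f j ≡ y
        closeY = trans (cong (λ t → iter t f j) (sym k≡)) jk≡y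
        walk-j-unique : Unique (walk f j (suc lb))
        walk-j-unique = walk-unique f f-injective j (λ 1≤u u<2+lb → noReturn 1≤u (s≤s⁻¹ u<2+lb)) (n≤1+n (suc lb))
        j∉targets : j ∉ walk f i (suc la) ++ walk f j (suc lb)
        j∉targets j∈ with ∈-++⁻ (walk f i (suc la)) j∈
        ... | inj₁ j∈i = orbit-i∌orbit-j {u = 0} j∈i refl
        ... | inj₂ j∈j = noReturn⇒walk-∌ f j noReturn j∈j
        j∷targets-unique : Unique (j ∷ walk f i (suc la) ++ walk f j (suc lb))
        j∷targets-unique = ¬Any⇒All¬ _ j∉targets
          ∷ Unique.++⁺ walk-i-unique walk-j-unique walk-i∩walk-j
        targets≡ : walk f i (suc la) ++ walk f j (suc lb) ≡ (walk f i la ∷ʳ i) ++ (walk f j lb ∷ʳ y)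
        targets≡ = cong₂ _++_ walk-i-snoc (trans (walk-snoc f j lb) (cong (walk f j lb ∷ʳ_) closeY))
        arrange : j ∷ (walk f i la ∷ʳ i) ++ (walk f j lb ∷ʳ y) ↭ i ∷ j ∷ y ∷ pathWalk la lb
        arrange = ↭-trans (prep j (snoc-blocks₂-↭ i y (walk f i la) (walk f j lb))) (swap j i ↭-refl)

    length-cycleWalk : ∀ la lb₁ lb₂ → length (cycleWalk la lb₁ lb₂) ≡ la + (lb₁ + lb₂)
    length-cycleWalk la lb₁ lb₂ =
      trans (List.length-++ (walk f i la)) (cong₂ _+_ (length-walk f i la)
            (trans (List.length-++ (walk f j lb₁)) (cong₂ _+_ (length-walk f j lb₁) (length-walk f y lb₂))))

    length-pathWalk : ∀ la lb → length (pathWalk la lb) ≡ la + lb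
    length-pathWalk la lb = trans (List.length-++ (walk f i la)) (cong₂ _+_ (length-walk f i la) (length-walk f j lb))

    witnesses-of : ∀ {L t} {T : Set t} (P : List (Fin n) → List (Fin n × Fin n)) (T? : Dec T) (xs₀ : List (Fin n)) →
      length xs₀ ≡ L → (∀ xs → length xs ≡ L → (Unique (i ∷ j ∷ y ∷ xs) × Extends (P xs) π) ⇔ (T × xs ≡ xs₀)) →
      ∑[ s ∈ allMaps L n ] 𝟙 (unique? (i ∷ j ∷ y ∷ toList s)) * 𝟙 (extends? (P (toList s)) π) ≡ 𝟙 T?
    witnesses-of {L} P T? xs₀ |xs₀| characterisation =
      trans (∑-cong (allMaps L n) (λ s → sym (𝟙-× (unique? (i ∷ j ∷ y ∷ toList s)) (extends? (P (toList s)) π))))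
            (count-unique-witness (λ s → unique? (i ∷ j ∷ y ∷ toList s) ×-dec extends? (P (toList s)) π) T? xs₀ |xs₀|
                                  (λ s → characterisation (toList s) (length-toList s)))

    module _ (f-injective : Injective _≡_ _≡_ f) {la : ℕ} (d∣k : suc la ∣ k) (d≤k : suc la ≤ k) where

      cycle-count : ∀ {lb₁ lb₂} → suc lb₁ + suc lb₂ ≤ k → k % (suc lb₁ + suc lb₂) ≡ suc lb₁ →
        ∑[ s ∈ allMaps (la + (lb₁ + lb₂)) n ] 𝟙 (unique? (i ∷ j ∷ y ∷ toList s)) * 𝟙 (extends? (cyclePairs la lb₁ (toList s)) π)
          ≡ 𝟙 (condition? (suc la) (just (suc lb₁ + suc lb₂)))
      cycle-count {lb₁} {lb₂} e≤k k%e≡ =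
        witnesses-of (cyclePairs la lb₁) (condition? (suc la) (just e)) (cycleWalk la lb₁ lb₂) (length-cycleWalk la lb₁ lb₂)
                     λ xs |xs| → mk⇔ (to xs |xs|) (from xs |xs|)
        where
        e : ℕ
        e = suc lb₁ + suc lb₂
        to : ∀ xs → length xs ≡ la + (lb₁ + lb₂) →
          Unique (i ∷ j ∷ y ∷ xs) × Extends (cyclePairs la lb₁ xs) π → Condition (suc la) (just e) × xs ≡ cycleWalk la lb₁ lb₂
        to xs |xs| (!ijyxs , ext) with Equivalence.to (cycle-extends⇔ la lb₁ lb₂ xs |xs|) ext
        ... | xs≡ , closed = cycle-condition⁺ d≤k e≤k k%e≡ (subst (λ l → Unique (i ∷ j ∷ y ∷ l)) xs≡ !ijyxs) closed , xs≡
        from : ∀ xs → length xs ≡ la + (lb₁ + lb₂) →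
          Condition (suc la) (just e) × xs ≡ cycleWalk la lb₁ lb₂ → Unique (i ∷ j ∷ y ∷ xs) × Extends (cyclePairs la lb₁ xs) π
        from xs |xs| ((ret-i , ret-j , jk≡y) , xs≡) with Reconstruction.cycle-condition⁻ f-injective d∣k ret-i jk≡y k%e≡ ret-j
        ... | closed , !ijyW =
          subst (λ l → Unique (i ∷ j ∷ y ∷ l)) (sym xs≡) !ijyW , Equivalence.from (cycle-extends⇔ la lb₁ lb₂ xs |xs|) (xs≡ , closed)

      path-count : ∀ {lb} → k ≡ suc lb →
        ∑[ s ∈ allMaps (la + lb) n ] 𝟙 (unique? (i ∷ j ∷ y ∷ toList s)) * 𝟙 (extends? (pathPairs la (toList s)) π)
          ≡ 𝟙 (condition? (suc la) nothing)
      path-count {lb} k≡ =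
        witnesses-of (pathPairs la) (condition? (suc la) nothing) (pathWalk la lb) (length-pathWalk la lb)
                     λ xs |xs| → mk⇔ (to xs |xs|) (from xs |xs|)
        where
        to : ∀ xs → length xs ≡ la + lb →
          Unique (i ∷ j ∷ y ∷ xs) × Extends (pathPairs la xs) π → Condition (suc la) nothing × xs ≡ pathWalk la lb
        to xs |xs| (!ijyxs , ext) with Equivalence.to (path-extends⇔ la lb xs |xs|) ext
        ... | xs≡ , closed = path-condition⁺ d≤k k≡ (subst (λ l → Unique (i ∷ j ∷ y ∷ l)) xs≡ !ijyxs) closed , xs≡
        from : ∀ xs → length xs ≡ la + lb →
          Condition (suc la) nothing × xs ≡ pathWalk la lb → Unique (i ∷ j ∷ y ∷ xs) × Extends (pathPairs la xs) π
        from xs |xs| ((ret-i , ret-j , jk≡y) , xs≡) with Reconstruction.path-condition⁻ f-injective d∣k ret-i jk≡y k≡ ret-j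
        ... | closed , !ijyW =
          subst (λ l → Unique (i ∷ j ∷ y ∷ l)) (sym xs≡) !ijyW , Equivalence.from (path-extends⇔ la lb xs |xs|) (xs≡ , closed)

-- Splitting by the return times of i and j

nonDivisors : ℕ → List ℕ
nonDivisors k = filter (λ e → ¬? (e ∣? k)) (map suc (upTo k))

∈-range⁺ : ∀ {k d} → 1 ≤ d → d ≤ k → d ∈ map suc (upTo k)
∈-range⁺ {d = suc d} _ d<k = ∈-map⁺ suc (∈-upTo⁺ d<k)

∈-range⁻ : ∀ {k d} → d ∈ map suc (upTo k) → 1 ≤ d × d ≤ k
∈-range⁻ d∈ with ∈-map⁻ suc d∈
... | _ , c∈ , refl = s≤s z≤n , ∈-upTo⁻ c∈

unique-range : ∀ k → Unique (map suc (upTo k))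
unique-range k = Unique.map⁺ suc-injective (Unique.upTo⁺ k)

module Decomposition {n : ℕ} (k : ℕ) (i j y : Fin n) (y≢j : y ≢ j) where

  open Shapes k i j y y≢j

  returnTimesOfJ : List (Maybe ℕ)
  returnTimesOfJ = map just (nonDivisors k) ++ [ nothing ]

  unique-returnTimesOfJ : Unique returnTimesOfJ
  unique-returnTimesOfJ = Unique.++⁺ (Unique.map⁺ Maybe.just-injective (Unique.filter⁺ _ (unique-range k))) ([] ∷ [])
                                     λ { (nothing∈ , here refl) → case∉ nothing∈ }
    where
    case∉ : nothing ∉ map just (nonDivisors k)
    case∉ nothing∈ with ∈-map⁻ just nothing∈
    ... | _ , _ , ()

  module _ (π : Vec (Fin n) n) where

    open Orbit π

    ∑-returnTime-i : 1 ≤ k → ∑[ d ∈ divisors k ] 𝟙 (ret i ≟ᵐ just d) ≡ 𝟙 (iter k f i ≟ᶠ i)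
    ∑-returnTime-i 1≤k with iter k f i ≟ᶠ i
    ... | no moves = trans (sym (∑-map just (divisors k) (λ m → 𝟙 (ret i ≟ᵐ m)))) (count-≡-∉ _≟ᵐ_ (map just (divisors k)) ret∉)
      where
      ret∉ : ret i ∉ map just (divisors k)
      ret∉ ret∈ with ∈-map⁻ just ret∈
      ... | d , d∈ , ret≡ with returnTime-just⇒ f _≟ᶠ_ {k} ret≡
      ...   | _ , _ , fixed , _ = moves (iter-∣-fixed f i (proj₂ (∈-filter⁻ (_∣? k) {xs = map suc (upTo k)} d∈)) fixed)
    ... | yes fixed = trans (sym (∑-map just (divisors k) (λ m → 𝟙 (ret i ≟ᵐ m))))
                            (count-≡-∈ _≟ᵐ_ (map just (divisors k)) (Unique.map⁺ Maybe.just-injective (Unique.filter⁺ _ (unique-range k))) ret∈)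
      where
      ret∈ : ret i ∈ map just (divisors k)
      ret∈ with ret i in eq
      ... | nothing = ⊥-elim (returnTime-nothing⇒ f _≟ᶠ_ {k} eq 1≤k ≤-refl fixed)
      ... | just d with returnTime-just⇒ f _≟ᶠ_ {k} eq
      ...   | isRet@(1≤d , d≤k , _) = ∈-map⁺ just (∈-filter⁺ (_∣? k) (∈-range⁺ 1≤d d≤k) (returnTime-∣ f _≟ᶠ_ isRet fixed))

    ∑-returnTime-j : iter k f j ≡ y → ∑[ m ∈ returnTimesOfJ ] 𝟙 (ret j ≟ᵐ m) ≡ 1
    ∑-returnTime-j jk≡y = count-≡-∈ _≟ᵐ_ returnTimesOfJ unique-returnTimesOfJ ret∈
      where
      ret∈ : ret j ∈ returnTimesOfJ
      ret∈ with ret j in eq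
      ... | nothing = ∈-++⁺ʳ (map just (nonDivisors k)) (here refl)
      ... | just e with returnTime-just⇒ f _≟ᶠ_ {k} eq
      ...   | 1≤e , e≤k , period , _ = ∈-++⁺ˡ (∈-map⁺ just (∈-filter⁺ (λ e → ¬? (e ∣? k)) (∈-range⁺ 1≤e e≤k) e∤k))
        where
        e∤k : ¬ (e ∣ k)
        e∤k e∣k = y≢j (trans (sym jk≡y) (iter-∣-fixed f j e∣k period))

    decompose-by-returnTimes : 1 ≤ k →
      𝟙 (iter k f i ≟ᶠ i ×-dec iter k f j ≟ᶠ y) ≡ ∑[ d ∈ divisors k ] ∑[ m ∈ returnTimesOfJ ] 𝟙 (condition? d m)
    decompose-by-returnTimes 1≤k = begin
      𝟙 (iter k f i ≟ᶠ i ×-dec iter k f j ≟ᶠ y)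
        ≡⟨ 𝟙-× (iter k f i ≟ᶠ i) jk≟y ⟩
      𝟙 (iter k f i ≟ᶠ i) * 𝟙 jk≟y
        ≡⟨ cong (_* 𝟙 jk≟y) (∑-returnTime-i 1≤k) ⟨
      (∑[ d ∈ divisors k ] 𝟙 (ret i ≟ᵐ just d)) * 𝟙 jk≟y
        ≡⟨ ∑-*ʳ (divisors k) (λ d → 𝟙 (ret i ≟ᵐ just d)) _ ⟩
      ∑[ d ∈ divisors k ] 𝟙 (ret i ≟ᵐ just d) * 𝟙 jk≟y
        ≡⟨ ∑-cong (divisors k) (λ d → cong (𝟙 (ret i ≟ᵐ just d) *_) (split-j jk≟y)) ⟩
      ∑[ d ∈ divisors k ] 𝟙 (ret i ≟ᵐ just d) * (∑[ m ∈ returnTimesOfJ ] 𝟙 (ret j ≟ᵐ m) * 𝟙 jk≟y)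
        ≡⟨ ∑-cong (divisors k) (λ d → sym (∑-*ˡ returnTimesOfJ (𝟙 (ret i ≟ᵐ just d)) (λ m → 𝟙 (ret j ≟ᵐ m) * 𝟙 jk≟y))) ⟩
      ∑[ d ∈ divisors k ] ∑[ m ∈ returnTimesOfJ ] 𝟙 (ret i ≟ᵐ just d) * (𝟙 (ret j ≟ᵐ m) * 𝟙 jk≟y)
        ≡⟨ ∑-cong (divisors k) (λ d → ∑-cong returnTimesOfJ (λ m → sym (combine d m))) ⟩
      ∑[ d ∈ divisors k ] ∑[ m ∈ returnTimesOfJ ] 𝟙 (condition? d m) ∎
      where
      open ≡-Reasoning
      jk≟y : Dec (iter k f j ≡ y)
      jk≟y = iter k f j ≟ᶠ y
      split-j : (P? : Dec (iter k f j ≡ y)) → 𝟙 P? ≡ ∑[ m ∈ returnTimesOfJ ] 𝟙 (ret j ≟ᵐ m) * 𝟙 P?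
      split-j (yes jk≡y) = sym (trans (∑-cong returnTimesOfJ (λ m → *-identityʳ (𝟙 (ret j ≟ᵐ m)))) (∑-returnTime-j jk≡y))
      split-j (no _)     = sym (trans (∑-cong returnTimesOfJ (λ m → *-zeroʳ (𝟙 (ret j ≟ᵐ m)))) (∑-zero returnTimesOfJ))
      combine : ∀ d m → 𝟙 (condition? d m) ≡ 𝟙 (ret i ≟ᵐ just d) * (𝟙 (ret j ≟ᵐ m) * 𝟙 jk≟y)
      combine d m = trans (𝟙-× (ret i ≟ᵐ just d) _) (cong (𝟙 (ret i ≟ᵐ just d) *_) (𝟙-× (ret j ≟ᵐ m) jk≟y))

length-nonDivisors+τ : ∀ k → length (nonDivisors k) + τ k ≡ k
length-nonDivisors+τ k = begin
  length (nonDivisors k) + τ k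
    ≡⟨ cong₂ _+_ (length-filter (λ e → ¬? (e ∣? k)) range) (length-filter (_∣? k) range) ⟩
  (∑[ e ∈ range ] 𝟙 (¬? (e ∣? k))) + (∑[ e ∈ range ] 𝟙 (e ∣? k))
    ≡⟨ ∑-𝟙¬+∑-𝟙 (_∣? k) range ⟩
  length range
    ≡⟨ trans (List.length-map suc (upTo k)) (List.length-upTo k) ⟩
  k ∎
  where
  open ≡-Reasoning
  range : List ℕ
  range = map suc (upTo k)

sum≡∑ : ∀ xs → sum xs ≡ ∑[ x ∈ xs ] x
sum≡∑ []       = refl
sum≡∑ (x ∷ xs) = cong (_+_ x) (sum≡∑ xs)

divisor-identity : ∀ {k n} → (∀ {d} → d ∈ divisors k → d + k ≤ n) →
  (∑[ d ∈ divisors k ] (length (nonDivisors k) + (n ∸ (d + k)))) + σ k + τ k * τ k ≡ τ k * n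
divisor-identity {k} {n} d+k≤n = begin
  (∑[ d ∈ D ] (ν + (n ∸ (d + k)))) + σ k + τ k * τ k
    ≡⟨ cong₂ (λ a b → (∑[ d ∈ D ] (ν + (n ∸ (d + k)))) + a + b) (sum≡∑ D) (sym (∑-const D (τ k))) ⟩
  (∑[ d ∈ D ] (ν + (n ∸ (d + k)))) + (∑[ d ∈ D ] d) + (∑[ _ ∈ D ] τ k)
    ≡⟨ cong (_+ (∑[ _ ∈ D ] τ k)) (∑-+ D) ⟨
  (∑[ d ∈ D ] (ν + (n ∸ (d + k)) + d)) + (∑[ _ ∈ D ] τ k)
    ≡⟨ ∑-+ D ⟨
  ∑[ d ∈ D ] (ν + (n ∸ (d + k)) + d + τ k)
    ≡⟨ ∑-cong-∈ D divisor-term ⟩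
  ∑[ _ ∈ D ] n
    ≡⟨ ∑-const D n ⟩
  τ k * n ∎
  where
  open ≡-Reasoning
  D : List ℕ
  D = divisors k
  ν : ℕ
  ν = length (nonDivisors k)
  divisor-term : ∀ {d} → d ∈ D → ν + (n ∸ (d + k)) + d + τ k ≡ n
  divisor-term {d} d∈ = begin
    ν + (n ∸ (d + k)) + d + τ k   ≡⟨ rearrange ν (n ∸ (d + k)) d (τ k) ⟩
    d + (ν + τ k) + (n ∸ (d + k)) ≡⟨ cong (λ s → d + s + (n ∸ (d + k))) (length-nonDivisors+τ k) ⟩
    d + k + (n ∸ (d + k))         ≡⟨ m+[n∸m]≡n (d+k≤n d∈) ⟩
    n                             ∎
    where
    rearrange : ∀ a b c e → a + b + c + e ≡ c + (a + e) + b
    rearrange = solve-∀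

lookup-injective : ∀ {m n} (v : Vec (Fin n) m) → Unique (toList v) → Injective _≡_ _≡_ (lookup v)
lookup-injective (x ∷ v) _         {zero}  {zero}  _  = refl
lookup-injective (x ∷ v) (x∉ ∷ _)  {zero}  {suc t} eq = ⊥-elim (All.lookup x∉ (∈-toList⁺ (∈-lookup t v)) eq)
lookup-injective (x ∷ v) (x∉ ∷ _)  {suc s} {zero}  eq = ⊥-elim (All.lookup x∉ (∈-toList⁺ (∈-lookup s v)) (sym eq))
lookup-injective (x ∷ v) (_ ∷ !v)  {suc s} {suc t} eq = cong suc (lookup-injective v !v eq)

m≡1+[m∸1] : ∀ {m} → 1 ≤ m → m ≡ suc (m ∸ 1)
m≡1+[m∸1] (s≤s _) = refl

m∸n≡1+[m∸1+n] : ∀ {m n} → suc n ≤ m → m ∸ n ≡ suc (m ∸ suc n)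
m∸n≡1+[m∸1+n] {suc m} (s≤s n≤m) = +-∸-assoc 1 n≤m

3+[a+[b+c]]≡1+a+[1+b+1+c] : ∀ a b c → 3 + (a + (b + c)) ≡ suc a + (suc b + suc c)
3+[a+[b+c]]≡1+a+[1+b+1+c] = solve-∀

1+[r∸1]+1+[e∸1∸r]≡e : ∀ {r e} → 1 ≤ r → r < e → suc (r ∸ 1) + suc (e ∸ 1 ∸ r) ≡ e
1+[r∸1]+1+[e∸1∸r]≡e {suc r} {suc e} (s≤s _) (s≤s r<e) = trans (+-suc (suc r) (e ∸ suc r)) (cong suc (m+[n∸m]≡n r<e))

[n∸[3+L]]!*falling≡[n∸3]! : ∀ {n} L → 3 + L ≤ n → (n ∸ (3 + L)) ! * falling (n ∸ 3) L ≡ (n ∸ 3) !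
[n∸[3+L]]!*falling≡[n∸3]! {n} L 3+L≤n =
  trans (cong (λ a → a ! * falling (n ∸ 3) L) (sym (∸-+-assoc n 3 L)))
        ([a∸m]!*falling≡a! (m+n≤o⇒m≤o∸n L (subst (_≤ n) (+-comm 3 L) 3+L≤n)))

[n∸[2+L]]!*falling≡[n∸[2+L]]*[n∸3]! : ∀ {n} L → 3 + L ≤ n → (n ∸ (2 + L)) ! * falling (n ∸ 3) L ≡ (n ∸ (2 + L)) * (n ∸ 3) !
[n∸[2+L]]!*falling≡[n∸[2+L]]*[n∸3]! {n} L 3+L≤n = begin
  (n ∸ (2 + L)) ! * falling (n ∸ 3) L                  ≡⟨ cong (λ a → a ! * falling (n ∸ 3) L) n∸[2+L]≡ ⟩
  suc (n ∸ (3 + L)) * (n ∸ (3 + L)) ! * falling (n ∸ 3) L ≡⟨ *-assoc (suc (n ∸ (3 + L))) ((n ∸ (3 + L)) !) (falling (n ∸ 3) L) ⟩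
  suc (n ∸ (3 + L)) * ((n ∸ (3 + L)) ! * falling (n ∸ 3) L) ≡⟨ cong₂ _*_ (sym n∸[2+L]≡) ([n∸[3+L]]!*falling≡[n∸3]! L 3+L≤n) ⟩
  (n ∸ (2 + L)) * (n ∸ 3) !                            ∎
  where
  open ≡-Reasoning
  n∸[2+L]≡ : n ∸ (2 + L) ≡ suc (n ∸ (3 + L))
  n∸[2+L]≡ = m∸n≡1+[m∸1+n] 3+L≤n

module Counting {n : ℕ} (k : ℕ) (i j y : Fin n) (i≢j : i ≢ j) (y≢i : y ≢ i) (y≢j : y ≢ j) where

  open Shapes k i j y y≢j
  open Decomposition k i j y y≢j

  -- k mod e; the junk value at e = 0 is harmless since 0 is never a return time.
  remainder : ℕ → ℕ
  remainder zero    = 0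
  remainder (suc e) = k % suc e

  shapeSize : Maybe ℕ → ℕ
  shapeSize (just _) = 3
  shapeSize nothing  = 2

  shapeLength : ℕ → Maybe ℕ → ℕ
  shapeLength d (just e) = (d ∸ 1) + ((remainder e ∸ 1) + (e ∸ 1 ∸ remainder e))
  shapeLength d nothing  = (d ∸ 1) + (k ∸ 1)

  shapePairs : ℕ → Maybe ℕ → List (Fin n) → List (Fin n × Fin n)
  shapePairs d (just e) = cyclePairs (d ∸ 1) (remainder e ∸ 1)
  shapePairs d nothing  = pathPairs (d ∸ 1)

  shape-valid : ∀ d m xs → Unique (i ∷ j ∷ y ∷ xs) →
    Unique (map proj₁ (shapePairs d m xs)) × Unique (map proj₂ (shapePairs d m xs)) × length (shapePairs d m xs) ≡ shapeSize m + length xs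
  shape-valid d (just e) = cycle-valid (d ∸ 1) (remainder e ∸ 1)
  shape-valid d nothing  = path-valid (d ∸ 1)

  unique-ijy : Unique (i ∷ j ∷ y ∷ [])
  unique-ijy = (i≢j All.∷ (λ i≡y → y≢i (sym i≡y)) All.∷ All.[]) ∷ ((λ j≡y → y≢j (sym j≡y)) All.∷ All.[]) ∷ All.[] ∷ []

  divisor-facts : ∀ {d} → d ∈ divisors k → 1 ≤ d × d ≤ k × d ∣ k
  divisor-facts d∈ with ∈-filter⁻ (_∣? k) {xs = map suc (upTo k)} d∈
  ... | d∈range , d∣k = proj₁ (∈-range⁻ d∈range) , proj₂ (∈-range⁻ d∈range) , d∣k

  nonDivisor-facts : ∀ {e} → e ∈ nonDivisors k → 1 ≤ e × e ≤ k × 1 ≤ remainder e × remainder e < e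
  nonDivisor-facts {suc e} e∈ with ∈-filter⁻ (λ e → ¬? (e ∣? k)) {xs = map suc (upTo k)} e∈
  ... | e∈range , e∤k = s≤s z≤n , proj₂ (∈-range⁻ e∈range) , 1≤r (k % suc e) refl , m%n<n k (suc e)
    where
    1≤r : ∀ r → k % suc e ≡ r → 1 ≤ r
    1≤r zero    r≡0 = ⊥-elim (e∤k (m%n≡0⇒n∣m k (suc e) r≡0))
    1≤r (suc r) _   = s≤s z≤n
  nonDivisor-facts {zero} e∈ with ∈-range⁻ (proj₁ (∈-filter⁻ (λ e → ¬? (e ∣? k)) {xs = map suc (upTo k)} e∈))
  ... | () , _

  module _ (π : Vec (Fin n) n) where

    open Orbit π

    witnesses : ℕ → Maybe ℕ → ℕ
    witnesses d m = ∑[ s ∈ allMaps (shapeLength d m) n ] 𝟙 (unique? (i ∷ j ∷ y ∷ toList s)) * 𝟙 (extends? (shapePairs d m (toList s)) π)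

    module _ (f-injective : Injective _≡_ _≡_ (lookup π)) where

      cycle-witnesses : ∀ {la e} → suc la ∈ divisors k → e ∈ nonDivisors k → witnesses (suc la) (just e) ≡ 𝟙 (condition? (suc la) (just e))
      cycle-witnesses {e = zero} _ e∈ with nonDivisor-facts e∈
      ... | () , _
      cycle-witnesses {la} {suc e} d∈ e∈ with divisor-facts d∈ | nonDivisor-facts e∈
      ... | _ , d≤k , d∣k | _ , e≤k , 1≤r , r<e =
        subst (λ e′ → witnesses (suc la) (just (suc e)) ≡ 𝟙 (condition? (suc la) (just e′))) split
              (cycle-count f-injective d∣k d≤k (subst (_≤ k) (sym split) e≤k)
                           (trans (cong (λ x → k % suc x) (suc-injective split)) (m≡1+[m∸1] {k % suc e} 1≤r)))
        where
        split : suc (k % suc e ∸ 1) + suc (e ∸ k % suc e) ≡ suc e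
        split = 1+[r∸1]+1+[e∸1∸r]≡e 1≤r r<e

      witnesses≡𝟙 : ∀ {d m} → d ∈ divisors k → m ∈ returnTimesOfJ → witnesses d m ≡ 𝟙 (condition? d m)
      witnesses≡𝟙 {zero} d∈ _ with divisor-facts d∈
      ... | () , _
      witnesses≡𝟙 {suc la} d∈ m∈ with ∈-++⁻ (map just (nonDivisors k)) m∈
      ... | inj₂ (here refl) with divisor-facts d∈
      ...   | _ , d≤k , d∣k = path-count f-injective d∣k d≤k (m≡1+[m∸1] (≤-trans (s≤s z≤n) d≤k))
      witnesses≡𝟙 {suc la} d∈ m∈ | inj₁ m∈cycles with ∈-map⁻ just m∈cycles
      ... | e , e∈ , refl = cycle-witnesses d∈ e∈

  count≡∑-shapes : 1 ≤ k →
    ∑[ π ∈ allMaps n n ] 𝟙 (unique? (toList π)) * 𝟙 (iter k (lookup π) i ≟ᶠ i ×-dec iter k (lookup π) j ≟ᶠ y)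
      ≡ ∑[ d ∈ divisors k ] ∑[ m ∈ returnTimesOfJ ] (n ∸ (shapeSize m + shapeLength d m)) ! * falling (n ∸ 3) (shapeLength d m)
  count≡∑-shapes 1≤k = begin
    ∑[ π ∈ Πs ] 𝟙 (unique? (toList π)) * 𝟙 (iter k (lookup π) i ≟ᶠ i ×-dec iter k (lookup π) j ≟ᶠ y)
      ≡⟨ ∑-cong Πs (λ π → 𝟙-*-cong (unique? (toList π)) (λ !π → trans (decompose-by-returnTimes π 1≤k)
           (∑-cong-∈ Ds (λ d∈ → ∑-cong-∈ Ms (λ m∈ → sym (witnesses≡𝟙 π (lookup-injective π !π) d∈ m∈)))))) ⟩
    ∑[ π ∈ Πs ] 𝟙 (unique? (toList π)) * (∑[ d ∈ Ds ] ∑[ m ∈ Ms ] witnesses π d m)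
      ≡⟨ ∑-cong Πs (λ π → trans (sym (∑-*ˡ Ds (𝟙 (unique? (toList π))) (λ d → ∑ Ms (witnesses π d))))
                              (∑-cong Ds (λ d → sym (∑-*ˡ Ms (𝟙 (unique? (toList π))) (witnesses π d))))) ⟩
    ∑[ π ∈ Πs ] ∑[ d ∈ Ds ] ∑[ m ∈ Ms ] 𝟙 (unique? (toList π)) * witnesses π d m
      ≡⟨ ∑-comm Πs Ds (λ π d → ∑[ m ∈ Ms ] 𝟙 (unique? (toList π)) * witnesses π d m) ⟩
    ∑[ d ∈ Ds ] ∑[ π ∈ Πs ] ∑[ m ∈ Ms ] 𝟙 (unique? (toList π)) * witnesses π d m
      ≡⟨ ∑-cong Ds (λ d → ∑-comm Πs Ms (λ π m → 𝟙 (unique? (toList π)) * witnesses π d m)) ⟩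
    ∑[ d ∈ Ds ] ∑[ m ∈ Ms ] ∑[ π ∈ Πs ] 𝟙 (unique? (toList π)) * witnesses π d m
      ≡⟨ ∑-cong Ds (λ d → ∑-cong Ms (λ m →
           count-extensions-of-fresh-words (shapeSize m) (i ∷ j ∷ y ∷ []) (shapePairs d m) unique-ijy (shape-valid d m))) ⟩
    ∑[ d ∈ Ds ] ∑[ m ∈ Ms ] (n ∸ (shapeSize m + shapeLength d m)) ! * falling (n ∸ 3) (shapeLength d m) ∎
    where
    open ≡-Reasoning
    Πs : List (Vec (Fin n) n)
    Πs = allMaps n n
    Ds : List ℕ
    Ds = divisors k
    Ms : List (Maybe ℕ)
    Ms = returnTimesOfJ

  size-cycle : ∀ {d e} → d ∈ divisors k → e ∈ nonDivisors k → 3 + shapeLength d (just e) ≡ d + e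
  size-cycle {d} {e} d∈ e∈ with divisor-facts d∈ | nonDivisor-facts e∈
  ... | 1≤d , _ | _ , _ , 1≤r , r<e = begin
    3 + ((d ∸ 1) + ((remainder e ∸ 1) + (e ∸ 1 ∸ remainder e)))         ≡⟨ 3+[a+[b+c]]≡1+a+[1+b+1+c] (d ∸ 1) _ _ ⟩
    suc (d ∸ 1) + (suc (remainder e ∸ 1) + suc (e ∸ 1 ∸ remainder e))   ≡⟨ cong₂ _+_ (sym (m≡1+[m∸1] 1≤d)) (1+[r∸1]+1+[e∸1∸r]≡e 1≤r r<e) ⟩
    d + e                                                                ∎
    where open ≡-Reasoning

  size-path : ∀ {d} → d ∈ divisors k → 2 + shapeLength d nothing ≡ d + k
  size-path {d} d∈ with divisor-facts d∈
  ... | 1≤d , d≤k , _ = begin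
    2 + ((d ∸ 1) + (k ∸ 1))          ≡⟨ cong suc (+-suc (d ∸ 1) (k ∸ 1)) ⟨
    suc (d ∸ 1) + suc (k ∸ 1)        ≡⟨ cong₂ _+_ (sym (m≡1+[m∸1] 1≤d)) (sym (m≡1+[m∸1] (≤-trans 1≤d d≤k))) ⟩
    d + k                            ∎
    where open ≡-Reasoning

  module _ (2k+1≤n : 2 * k + 1 ≤ n) where

    k+k<n : k + k < n
    k+k<n = subst (_≤ n) (trans (+-comm (2 * k) 1) (cong (λ m → suc (k + m)) (+-identityʳ k))) 2k+1≤n

    d+k<n : ∀ {d} → d ∈ divisors k → d + k < n
    d+k<n d∈ with divisor-facts d∈
    ... | _ , d≤k , _ = ≤-<-trans (+-monoˡ-≤ k d≤k) k+k<n

    cycle-term : ∀ {d e} → d ∈ divisors k → e ∈ nonDivisors k →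
      (n ∸ (3 + shapeLength d (just e))) ! * falling (n ∸ 3) (shapeLength d (just e)) ≡ (n ∸ 3) !
    cycle-term {d} {e} d∈ e∈ with divisor-facts d∈ | nonDivisor-facts e∈
    ... | _ , d≤k , _ | _ , e≤k , _ =
      [n∸[3+L]]!*falling≡[n∸3]! (shapeLength d (just e))
        (subst (_≤ n) (sym (size-cycle d∈ e∈)) (≤-trans (+-monoʳ-≤ d e≤k) (<⇒≤ (d+k<n d∈))))

    path-term : ∀ {d} → d ∈ divisors k →
      (n ∸ (2 + shapeLength d nothing)) ! * falling (n ∸ 3) (shapeLength d nothing) ≡ (n ∸ (d + k)) * (n ∸ 3) !
    path-term {d} d∈ with divisor-facts d∈
    ... | _ , d≤k , _ =
      trans ([n∸[2+L]]!*falling≡[n∸[2+L]]*[n∸3]! (shapeLength d nothing) (subst (_< n) (sym (size-path d∈)) (d+k<n d∈)))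
            (cong (λ l → (n ∸ l) * (n ∸ 3) !) (size-path d∈))

    ∑-shapes-of-divisor : ∀ {d} → d ∈ divisors k →
      ∑[ m ∈ returnTimesOfJ ] (n ∸ (shapeSize m + shapeLength d m)) ! * falling (n ∸ 3) (shapeLength d m)
        ≡ (n ∸ 3) ! * (length (nonDivisors k) + (n ∸ (d + k)))
    ∑-shapes-of-divisor {d} d∈ = begin
      ∑[ m ∈ returnTimesOfJ ] T m
        ≡⟨ ∑-++ (map just (nonDivisors k)) [ nothing ] T ⟩
      ∑ (map just (nonDivisors k)) T + (T nothing + 0)
        ≡⟨ cong₂ _+_ (∑-map just (nonDivisors k) T) (+-identityʳ (T nothing)) ⟩
      (∑[ e ∈ nonDivisors k ] T (just e)) + T nothing
        ≡⟨ cong₂ _+_ (trans (∑-cong-∈ (nonDivisors k) (cycle-term d∈)) (∑-const (nonDivisors k) ((n ∸ 3) !))) (path-term d∈) ⟩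
      length (nonDivisors k) * (n ∸ 3) ! + (n ∸ (d + k)) * (n ∸ 3) !
        ≡⟨ *-distribʳ-+ ((n ∸ 3) !) (length (nonDivisors k)) (n ∸ (d + k)) ⟨
      (length (nonDivisors k) + (n ∸ (d + k))) * (n ∸ 3) !
        ≡⟨ *-comm _ ((n ∸ 3) !) ⟩
      (n ∸ 3) ! * (length (nonDivisors k) + (n ∸ (d + k))) ∎
      where
      open ≡-Reasoning
      T : Maybe ℕ → ℕ
      T m = (n ∸ (shapeSize m + shapeLength d m)) ! * falling (n ∸ 3) (shapeLength d m)

    count-closed-form : 1 ≤ k → count n k i j y ≡ (n ∸ 3) ! * (∑[ d ∈ divisors k ] (length (nonDivisors k) + (n ∸ (d + k))))
    count-closed-form 1≤k = begin
      count n k i j y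
        ≡⟨ length-filter-filter (λ π → unique? (toList π)) (λ π → iter k (lookup π) i ≟ᶠ i ×-dec iter k (lookup π) j ≟ᶠ y)
                                (allMaps n n) ⟩
      ∑[ π ∈ allMaps n n ] 𝟙 (unique? (toList π)) * 𝟙 (iter k (lookup π) i ≟ᶠ i ×-dec iter k (lookup π) j ≟ᶠ y)
        ≡⟨ count≡∑-shapes 1≤k ⟩
      ∑[ d ∈ divisors k ] ∑[ m ∈ returnTimesOfJ ] (n ∸ (shapeSize m + shapeLength d m)) ! * falling (n ∸ 3) (shapeLength d m)
        ≡⟨ ∑-cong-∈ (divisors k) ∑-shapes-of-divisor ⟩
      ∑[ d ∈ divisors k ] (n ∸ 3) ! * (length (nonDivisors k) + (n ∸ (d + k)))
        ≡⟨ ∑-*ˡ (divisors k) ((n ∸ 3) !) _ ⟩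
      (n ∸ 3) ! * (∑[ d ∈ divisors k ] (length (nonDivisors k) + (n ∸ (d + k)))) ∎
      where open ≡-Reasoning

+[a+b+c]-c-b≡+a : ∀ a b c → + (a + b + c) - + c - + b ≡ + a
+[a+b+c]-c-b≡+a a b c = trans (cong (λ z → z - + c - + b) (trans (ℤ.pos-+ (a + b) c) (cong (_+ℤ + c) (ℤ.pos-+ a b))))
                               (cancel (+ a) (+ b) (+ c))
  where
  cancel : ∀ (a b c : ℤ) → a +ℤ b +ℤ c - c - b ≡ a
  cancel = ℤ-Solver.solve-∀

lemma2p3 : (k n : ℕ) → 1 ≤ k → 2 * k + 1 ≤ n → (i j y : Fin n) → i ≢ j → y ≢ i → y ≢ j →
    + count n k i j y ≡ (+ (τ k * n) - + (τ k * τ k) - + σ k) *ℤ + ((n ∸ 3) !)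
lemma2p3 k n 1≤k 2k+1≤n i j y i≢j y≢i y≢j = begin
  + count n k i j y
    ≡⟨ cong +_ (count-closed-form 2k+1≤n 1≤k) ⟩
  + ((n ∸ 3) ! * S)
    ≡⟨ trans (ℤ.pos-* ((n ∸ 3) !) S) (ℤ.*-comm (+ ((n ∸ 3) !)) (+ S)) ⟩
  + S *ℤ + ((n ∸ 3) !)
    ≡⟨ cong (_*ℤ + ((n ∸ 3) !)) (sym (+[a+b+c]-c-b≡+a S (σ k) (τ k * τ k))) ⟩
  (+ (S + σ k + τ k * τ k) - + (τ k * τ k) - + σ k) *ℤ + ((n ∸ 3) !)
    ≡⟨ cong (λ m → (+ m - + (τ k * τ k) - + σ k) *ℤ + ((n ∸ 3) !)) (divisor-identity (<⇒≤ ∘ d+k<n 2k+1≤n)) ⟩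
  (+ (τ k * n) - + (τ k * τ k) - + σ k) *ℤ + ((n ∸ 3) !) ∎
  where
  open ≡-Reasoning
  open Counting k i j y i≢j y≢i y≢j
  S : ℕ
  S = ∑[ d ∈ divisors k ] (length (nonDivisors k) + (n ∸ (d + k)))
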